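{- Let $n>2$ and $q>2$. Then there exists an orientable sequence of order $n$ over $\mathbb{Z}_q$ with period at least \[ \begin{cases} q\bigl(q^{n-1}-r_{q,n-1,(n-1)q/2}-2\bigr)/2 & \text{if } q\neq 6,\\ q\bigl(q^{n-1}-r_{q,n-1,(n-1)q/2}-4\bigr)/2 & \text{if } q=6, \end{cases} \] where $r_{q,k,s}$ denotes the number of $q$-ary $k$-tuples with pseudoweight exactly $s$.
   Context: Sequences are periodic with entries in $\mathbb{Z}_q$. For a sequence $S=(s_i)$ write $\mathbf{s}_n(i)=(s_i,\ldots,s_{i+n-1})$, and for an $n$-tuple $\mathbf{u}=(u_0,\ldots,u_{n-1})$ let $\mathbf{u}^R=(u_{n-1},\ldots,u_0)$. A periodic sequence $S$ of period $m$ is an $n$-window sequence if $\mathbf{s}_n(i)=\mathbf{s}_n(j)$ implies $i\equiv j\pmod m$; it is an orientable sequence of order $n$ if moreover $\mathbf{s}_n(i)\neq\mathbf{s}_n(j)^R$ for all $i,j$. Pseudoweight: define $f:\mathbb{Z}_q\to\mathbb{Q}$ by treating $u\in\mathbb{Z}_q$ as an integer in $[0,q-1]$ and setting $f(u)=u$ if $u\neq 0$ and $f(0)=q/2$. The pseudoweight of a tuple $(u_0,\ldots,u_{k-1})$ is $\sum_{i=0}^{k-1} f(u_i)$ computed in $\mathbb{Q}$. -}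

module Defs where

open import Data.Nat as ℕ using (ℕ; zero; suc; _+_; _*_; _∸_; _^_; _<_)
open import Data.Integer as ℤ using (ℤ; +_)
open import Data.Integer.Divisibility as ℤD using ()
open import Data.Fin using (Fin; toℕ)
open import Data.Vec using (Vec; []; _∷_; tabulate; reverse; foldr)
open import Data.List as L using (List; length; filter; concatMap; allFin)
import Data.List
open import Data.Rational as ℚ using (ℚ)
open import Data.Rational.Properties using () renaming (_≟_ to _≟ℚ_)
open import Relation.Binary.PropositionalEquality using (_≡_)
open import Relation.Nullary using (¬_)

_≡_[mod_] : ℕ → ℕ → ℕ → Set
i ≡ j [mod m ] = (+ m) ℤD.∣ ((+ i) ℤ.- (+ j))

Periodic : {q : ℕ} → ℕ → (ℕ → Fin q) → Set
Periodic m s = ∀ i → s (i + m) ≡ s i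

window : {q : ℕ} → (n : ℕ) → (ℕ → Fin q) → ℕ → Vec (Fin q) n
window n s i = tabulate (λ j → s (i + toℕ j))

IsWindowSeq : {q : ℕ} → ℕ → ℕ → (ℕ → Fin q) → Set
IsWindowSeq n m s = ∀ i j → window n s i ≡ window n s j → i ≡ j [mod m ]

IsOrientable : {q : ℕ} → ℕ → ℕ → (ℕ → Fin q) → Set
IsOrientable n m s =
  IsWindowSeq n m s × (∀ i j → ¬ (window n s i ≡ reverse (window n s j)))
  where open import Data.Product using (_×_)

pf : (q : ℕ) → Fin q → ℚ
pf q u with toℕ u
... | zero = (+ q) ℚ./ 2
... | suc k = (+ suc k) ℚ./ 1

pseudoweight : {q k : ℕ} → Vec (Fin q) k → ℚ
pseudoweight {q} = foldr _ (λ u acc → pf q u ℚ.+ acc) ℚ.0ℚ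

allTuples : (q k : ℕ) → List (Vec (Fin q) k)
allTuples q zero = [] L.∷ L.[]
allTuples q (suc k) = concatMap (λ u → L.map (u ∷_) (allTuples q k)) (allFin q)

r : (q k : ℕ) → ℚ → ℕ
r q k s = length (filter (λ v → pseudoweight v ≟ℚ s) (allTuples q k))

{-# OPTIONS --safe #-}
-- Write k = n - 1 and call a k-tuple light if its pseudoweight is below kq/2.  Negation u ↦ -u maps
-- heavy tuples injectively to light ones, so the number L of light tuples satisfies 2L + r_{q,k,kq/2} ≥ q^k.
-- The light tuples are closed under rotation and under replacing a letter by 1, so cycle-joining links
-- their rotation classes into one cycle of length L in the de Bruijn graph.  Every ⌈q/2⌉ consecutive
-- residues contain a unit of ℤ_q unless q = 6, so dropping one light loop c…c (two when q = 6) makes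
-- the sum W of the letters along the remaining cycle, of length m, coprime to q.  The partial sums s of
-- the cycle's letter sequence t, taken mod q, have period qm: an n-window of s determines a k-window of
-- t, hence the position mod m, and then s_i determines it mod qm because W is a unit.  The differences
-- of a reversed window are the negated reversed differences and f(u) + f(-u) = q, so a window of s
-- equal to a reversed one would yield two light k-windows of t of total pseudoweight kq.
module Submission where

open import Defs
open import Data.Nat using (ℕ; _<_; _*_; _∸_; _^_)
open import Data.Integer as ℤ using (+_)
open import Data.Rational as ℚ using (ℚ)
open import Data.Fin using (Fin)
open import Data.Product using (Σ; _×_)
open import Relation.Binary.PropositionalEquality using (_≡_)
open import Relation.Nullary using (¬_)

open import Level using (0ℓ)
open import Function using (_∘_; id)
open import Data.Empty using (⊥-elim)
open import Data.Product using (∃; ∃₂; _,_; proj₁; proj₂)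
open import Data.Sum using (_⊎_; inj₁; inj₂)
import Data.Sum
open import Data.Nat using (zero; suc; _+_; _≤_; NonZero; ∣_-_∣; _<?_; _≟_; z≤n; s≤s; z<s; s<s; s<s⁻¹; s≤s⁻¹)
open import Data.Nat.Properties
open import Data.Nat.DivMod
  using (_%_; _/_; _mod_; m≡m%n+[m/n]*n; [m+kn]%n≡m%n; [m+n]%n≡m%n; m<n⇒m%n≡m; n%n≡0; m%n<n; m%n%n≡m%n; %-distribˡ-+)
open import Data.Nat.Divisibility
  using (_∣_; divides; ∣⇒≤; 0∣⇒≡0; ∣n∣m%n⇒∣m; %-presˡ-∣; ∣m⇒∣m*n; *-monoˡ-∣; m%n≡0⇒n∣m)
open import Data.Nat.Coprimality using (Coprime; coprime-+; 1-coprimeTo; coprime-factors; coprime-divisor)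
import Data.Nat.Coprimality as Coprime
open import Data.Nat.GeneralisedArithmetic using (iterate)
open import Data.Nat.Induction using (<-wellFounded)
open import Data.Nat.ListAction using (sum)
open import Data.Nat.ListAction.Properties using (sum-++; sum-↭)
open import Data.Nat.Tactic.RingSolver using (solve-∀)
open import Data.Integer using (ℤ)
import Data.Integer.Properties as ℤ
import Data.Integer.Tactic.RingSolver as ℤ-Solver
import Data.Rational.Properties as ℚ
open import Data.Rational.Unnormalised as ℚᵘ using (mkℚᵘ; *≡*; *≤*)
import Data.Rational.Unnormalised.Properties as ℚᵘ
open import Data.Fin as Fin using (zero; suc; toℕ; fromℕ<; inject₁)
open import Data.Fin.Properties using (toℕ-fromℕ<; toℕ-injective; toℕ<n; toℕ-inject₁)
open import Data.Vec as V using (Vec; []; _∷_; _∷ʳ_; head; tail; replicate; toList; tabulate; lookup; reverse; last)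
import Data.Vec.Properties as Vecₚ
open Vecₚ
  using (≡-dec; toList-injective; length-toList; toList-∷ʳ; cast-is-id; ∷ʳ-injectiveˡ; tabulate-cong; tabulate∘lookup;
         reverse-∷; last-reverse)
open import Data.List using (List; []; _∷_; _++_; [_]; length; filter; map; concatMap; allFin; applyUpTo; cartesianProductWith)
import Data.List.Properties as Listₚ
open Listₚ using (++-assoc; ++-identityʳ; length-++; length-map; applyUpTo-∷ʳ; map-applyUpTo; length-tabulate; filter-all)
open import Data.List.Membership.Propositional using (_∈_; _∉_)
open import Data.List.Membership.Propositional.Properties
  using (∈-∃++; ∈-++⁺ˡ; ∈-++⁺ʳ; ∈-++⁻; ∈-applyUpTo⁺; ∈-applyUpTo⁻; ∈-filter⁺; ∈-filter⁻; ∈-map⁻; ∈-allFin;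
         ∈-cartesianProductWith⁺)
open import Data.List.Membership.DecPropositional using () renaming (_∈?_ to ∈?)
open import Data.List.Relation.Unary.Any using (here; there)
open import Data.List.Relation.Unary.All as All using (All; []; _∷_)
open import Data.List.Relation.Unary.Unique.Propositional using (Unique; []; _∷_)
open import Data.List.Relation.Unary.Unique.Propositional.Properties
  using (++⁺; applyUpTo⁺₁; cartesianProductWith⁺; allFin⁺; filter⁺; map⁺)
open import Data.List.Relation.Binary.Subset.Propositional using (_⊆_)
open import Data.List.Relation.Binary.Permutation.Propositional using (_↭_; ↭-refl; ↭-sym; ↭-trans; prep; ↭⇒↭ₛ)
open import Data.List.Relation.Binary.Permutation.Propositional.Properties
  using (shift; ↭-length; ∈-resp-↭) renaming (++-comm to ↭-++-comm; ++⁺ˡ to ↭-++⁺ˡ; map⁺ to ↭-map⁺)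
import Data.List.Relation.Binary.Permutation.Setoid.Properties as PermutationSetoid
open import Induction.WellFounded using (Acc; acc)
open import Relation.Nullary using (yes; no; contradiction)
open import Relation.Nullary.Decidable using (_×-dec_)
open import Relation.Unary using (Pred; Decidable)
open import Relation.Unary.Properties using (_∪?_)
open import Relation.Binary using (DecidableEquality; tri<; tri≈; tri>)
open import Relation.Binary.PropositionalEquality using (_≢_; refl; sym; trans; cong; cong₂; subst; setoid; module ≡-Reasoning)

least-witness : ∀ {P : Pred ℕ 0ℓ} → Decidable P → ∀ {n} → P n →
                ∃ λ m → m ≤ n × P m × (∀ {i} → i < m → ¬ P i)
least-witness P? {zero} p = 0 , z≤n , p , λ ()
least-witness P? {suc n} p with P? 0
... | yes p₀ = 0 , z≤n , p₀ , λ ()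
... | no ¬p₀ with least-witness (P? ∘ suc) p
...   | m , m≤n , pₘ , below = suc m , s≤s m≤n , pₘ , λ { {zero} _ → ¬p₀ ; {suc i} i<m → below (s<s⁻¹ i<m) }

module _ {A : Set} where

  Unique-⊆⇒length≤ : ∀ {xs ys : List A} → Unique xs → xs ⊆ ys → length xs ≤ length ys
  Unique-⊆⇒length≤ {[]} _ _ = z≤n
  Unique-⊆⇒length≤ {x ∷ xs} (x∉xs ∷ u) xs⊆ys with ∈-∃++ (xs⊆ys (here refl))
  ... | P , Q , refl = ≤-trans (s≤s (Unique-⊆⇒length≤ u xs⊆P++Q)) (≤-reflexive (sym (↭-length (shift x P Q))))
    where
    xs⊆P++Q : xs ⊆ P ++ Q
    xs⊆P++Q z∈xs with ∈-resp-↭ (shift x P Q) (xs⊆ys (there z∈xs))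
    ... | here refl = ⊥-elim (All.lookup x∉xs z∈xs refl)
    ... | there z∈P++Q = z∈P++Q

  length-filter-∪ : ∀ {P Q : Pred A 0ℓ} (P? : Decidable P) (Q? : Decidable Q) xs →
    length (filter (P? ∪? Q?) xs) ≤ length (filter P? xs) + length (filter Q? xs)
  length-filter-∪ P? Q? [] = z≤n
  length-filter-∪ P? Q? (x ∷ xs) with P? x | Q? x | length-filter-∪ P? Q? xs
  ... | yes _ | yes _ | ih = s≤s (≤-trans ih (+-monoʳ-≤ _ (n≤1+n _)))
  ... | yes _ | no  _ | ih = s≤s ih
  ... | no  _ | yes _ | ih = ≤-trans (s≤s ih) (≤-reflexive (sym (+-suc _ _)))
  ... | no  _ | no  _ | ih = ih

  rotl : List A → List A
  rotl [] = []
  rotl (x ∷ xs) = xs ++ [ x ]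

  rotl-++ : ∀ (u w : List A) → iterate rotl (u ++ w) (length u) ≡ w ++ u
  rotl-++ [] w = sym (++-identityʳ w)
  rotl-++ (x ∷ u) w rewrite ++-assoc u w [ x ] | rotl-++ u (w ++ [ x ]) = ++-assoc w [ x ] u

  at : A → List A → ℕ → A
  at d []       _       = d
  at d (x ∷ xs) zero    = x
  at d (x ∷ xs) (suc i) = at d xs i

  at-∈ : ∀ {d} xs {i} → i < length xs → at d xs i ∈ xs
  at-∈ (x ∷ xs) {zero}  _   = here refl
  at-∈ (x ∷ xs) {suc i} i<n = there (at-∈ xs (s<s⁻¹ i<n))

  at-injective : ∀ {d xs i j} → Unique xs → i < length xs → j < length xs → at d xs i ≡ at d xs j → i ≡ j
  at-injective {xs = x ∷ xs} {zero}  {zero}  _          _   _   _  = refl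
  at-injective {xs = x ∷ xs} {zero}  {suc j} (x∉ ∷ _)   _   j<n eq = ⊥-elim (All.lookup x∉ (at-∈ xs (s<s⁻¹ j<n)) eq)
  at-injective {xs = x ∷ xs} {suc i} {zero}  (x∉ ∷ _)   i<n _   eq = ⊥-elim (All.lookup x∉ (at-∈ xs (s<s⁻¹ i<n)) (sym eq))
  at-injective {xs = x ∷ xs} {suc i} {suc j} (_ ∷ uniq) i<n j<n eq = cong suc (at-injective uniq (s<s⁻¹ i<n) (s<s⁻¹ j<n) eq)

  at-++ˡ : ∀ {d} xs {ys i} → i < length xs → at d (xs ++ ys) i ≡ at d xs i
  at-++ˡ (x ∷ xs) {i = zero}  _   = refl
  at-++ˡ (x ∷ xs) {i = suc i} i<n = at-++ˡ xs (s<s⁻¹ i<n)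

  at-∷ʳ : ∀ {d} xs {y} → at d (xs ++ [ y ]) (length xs) ≡ y
  at-∷ʳ []       = refl
  at-∷ʳ (x ∷ xs) = at-∷ʳ xs

  applyUpTo-at : ∀ {d} xs → applyUpTo (at d xs) (length xs) ≡ xs
  applyUpTo-at []       = refl
  applyUpTo-at (x ∷ xs) = cong (x ∷_) (applyUpTo-at xs)

  applyUpTo-cong : ∀ {f g : ℕ → A} n → (∀ {i} → i < n → f i ≡ g i) → applyUpTo f n ≡ applyUpTo g n
  applyUpTo-cong zero    _   = refl
  applyUpTo-cong (suc n) f≡g = cong₂ _∷_ (f≡g z<s) (applyUpTo-cong n (f≡g ∘ s<s))

  first-failure : ∀ {P : Pred A 0ℓ} → Decidable P → ∀ xs →
                  All P xs ⊎ ∃₂ λ ys zs → ∃ λ x → xs ≡ ys ++ x ∷ zs × ¬ P x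
  first-failure P? [] = inj₁ []
  first-failure P? (x ∷ xs) with P? x | first-failure P? xs
  ... | no ¬px | _                               = inj₂ ([] , xs , x , refl , ¬px)
  ... | yes px | inj₁ all                        = inj₁ (px ∷ all)
  ... | yes _  | inj₂ (ys , zs , y , refl , ¬py) = inj₂ (x ∷ ys , zs , y , refl , ¬py)

  weigh : ∀ {n} → (A → ℕ) → Vec A n → ℕ
  weigh μ v = V.sum (V.map μ v)

  weigh-∷ʳ : ∀ {n} μ (w : Vec A n) c → weigh μ (w ∷ʳ c) ≡ weigh μ w + μ c
  weigh-∷ʳ μ []      c = +-comm (μ c) 0
  weigh-∷ʳ μ (x ∷ w) c = trans (cong (_+_ (μ x)) (weigh-∷ʳ μ w c)) (sym (+-assoc (μ x) _ _))

  weigh-map-complement : ∀ {n} μ f c → (∀ x → μ (f x) + μ x ≡ c) → (v : Vec A n) → weigh μ (V.map f v) + weigh μ v ≡ n * c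
  weigh-map-complement μ f c compl []      = refl
  weigh-map-complement μ f c compl (x ∷ v) = trans (lemma (μ (f x)) (weigh μ (V.map f v)) (μ x) (weigh μ v))
    (cong₂ _+_ (compl x) (weigh-map-complement μ f c compl v))
    where lemma : ∀ a b c d → (a + b) + (c + d) ≡ (a + c) + (b + d)
          lemma = solve-∀

  map-injective : ∀ {n} {f : A → A} → (∀ {x y} → f x ≡ f y → x ≡ y) → ∀ {v w : Vec A n} → V.map f v ≡ V.map f w → v ≡ w
  map-injective f-inj {[]}    {[]}    _  = refl
  map-injective f-inj {x ∷ v} {y ∷ w} eq = cong₂ _∷_ (f-inj (Vecₚ.∷-injectiveˡ eq)) (map-injective f-inj (Vecₚ.∷-injectiveʳ eq))

length-cartesianProductWith : ∀ {A B C : Set} (f : A → B → C) xs ys →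
                              length (cartesianProductWith f xs ys) ≡ length xs * length ys
length-cartesianProductWith f []       ys = refl
length-cartesianProductWith f (x ∷ xs) ys =
  trans (length-++ (map (f x) ys)) (cong₂ _+_ (length-map (f x) ys) (length-cartesianProductWith f xs ys))

m+k≡n⇒m≤n : ∀ {m n} k → m + k ≡ n → m ≤ n
m+k≡n⇒m≤n {m} k refl = m≤m+n m k

weigh-replicate : ∀ {A : Set} μ n (c : A) → weigh μ (replicate n c) ≡ n * μ c
weigh-replicate μ zero    c = refl
weigh-replicate μ (suc n) c = cong (_+_ (μ c)) (weigh-replicate μ n c)

Unique-resp-↭ : ∀ {A : Set} {xs ys : List A} → xs ↭ ys → Unique xs → Unique ys
Unique-resp-↭ {A} xs↭ys = PermutationSetoid.Unique-resp-↭ (setoid A) (↭⇒↭ₛ xs↭ys)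

-- Congruences modulo q

module _ {q : ℕ} .{{_ : NonZero q}} where

  %≡%⇒∣∸ : ∀ {a b} → a % q ≡ b % q → q ∣ b ∸ a
  %≡%⇒∣∸ {a} {b} eq = divides (b / q ∸ a / q) (begin
    b ∸ a                                    ≡⟨ cong₂ _∸_ (m≡m%n+[m/n]*n b q) (m≡m%n+[m/n]*n a q) ⟩
    (b % q + b / q * q) ∸ (a % q + a / q * q) ≡⟨ cong (λ x → (x + b / q * q) ∸ (a % q + a / q * q)) (sym eq) ⟩
    (a % q + b / q * q) ∸ (a % q + a / q * q) ≡⟨ [m+n]∸[m+o]≡n∸o (a % q) _ _ ⟩
    b / q * q ∸ a / q * q                    ≡⟨ *-distribʳ-∸ q (b / q) (a / q) ⟨
    (b / q ∸ a / q) * q                      ∎)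
    where open ≡-Reasoning

  %≡%⇒∣∣-∣ : ∀ a b → a % q ≡ b % q → q ∣ ∣ a - b ∣
  %≡%⇒∣∣-∣ a b eq with ∣m-n∣≡[m∸n]∨[n∸m] a b
  ... | inj₁ e = subst (q ∣_) (sym e) (%≡%⇒∣∸ (sym eq))
  ... | inj₂ e = subst (q ∣_) (sym e) (%≡%⇒∣∸ eq)

  ∣∸⇒%≡% : ∀ {a b} → a ≤ b → q ∣ b ∸ a → a % q ≡ b % q
  ∣∸⇒%≡% {a} {b} a≤b (divides d e) = begin
    a % q               ≡⟨ [m+kn]%n≡m%n a d q ⟨
    (a + d * q) % q     ≡⟨ cong (λ x → (a + x) % q) e ⟨
    (a + (b ∸ a)) % q   ≡⟨ cong (_% q) (m+[n∸m]≡n a≤b) ⟩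
    b % q               ∎
    where open ≡-Reasoning

  ∣∣-∣⇒%≡% : ∀ a b → q ∣ ∣ a - b ∣ → a % q ≡ b % q
  ∣∣-∣⇒%≡% a b q∣ with ≤-total a b
  ... | inj₁ a≤b = ∣∸⇒%≡% a≤b (subst (q ∣_) (m≤n⇒∣m-n∣≡n∸m a≤b) q∣)
  ... | inj₂ b≤a = sym (∣∸⇒%≡% b≤a (subst (q ∣_) (m≤n⇒∣n-m∣≡n∸m b≤a) q∣))

  %-cancelˡ-+ : ∀ c {a b} → (c + a) % q ≡ (c + b) % q → a % q ≡ b % q
  %-cancelˡ-+ c {a} {b} eq = ∣∣-∣⇒%≡% a b (subst (q ∣_) (∣m+n-m+o∣≡∣n-o∣ c a b) (%≡%⇒∣∣-∣ (c + a) (c + b) eq))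

  coprime-resp-% : ∀ {a b} → Coprime q a → a % q ≡ b % q → Coprime q b
  coprime-resp-% {a} {b} coprime eq (d∣q , d∣b) =
    coprime (d∣q , ∣n∣m%n⇒∣m d∣q (subst (_ ∣_) (sym eq) (%-presˡ-∣ d∣b d∣q)))

∣+i-+j∣≡∣i-j∣ : ∀ i j → ℤ.∣ + i ℤ.- + j ∣ ≡ ∣ i - j ∣
∣+i-+j∣≡∣i-j∣ i j with ≤-total i j
... | inj₁ i≤j = trans (cong ℤ.∣_∣ (ℤ.m-n≡m⊖n i j)) (trans (ℤ.∣⊖∣-≤ i≤j) (sym (m≤n⇒∣m-n∣≡n∸m i≤j)))
... | inj₂ j≤i = trans (cong ℤ.∣_∣ (trans (ℤ.m-n≡m⊖n i j) (ℤ.⊖-≥ j≤i))) (sym (m≤n⇒∣n-m∣≡n∸m j≤i))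

∣∣-∣⇒[mod] : ∀ {m} i j → m ∣ ∣ i - j ∣ → i ≡ j [mod m ]
∣∣-∣⇒[mod] {m} i j = subst (m ∣_) (sym (∣+i-+j∣≡∣i-j∣ i j))

[mod]⇒∣∣-∣ : ∀ {m} i j → i ≡ j [mod m ] → m ∣ ∣ i - j ∣
[mod]⇒∣∣-∣ {m} i j = subst (m ∣_) (∣+i-+j∣≡∣i-j∣ i j)

suc-% : ∀ i m .{{_ : NonZero m}} → suc i % m ≡ suc (i % m) % m
suc-% i m = trans (cong (λ x → suc x % m) (m≡m%n+[m/n]*n i m)) ([m+kn]%n≡m%n (suc (i % m)) (i / m) m)

-- Units of ℤ_q

coprime-double+ : ∀ {d e} → Coprime d e → Coprime (e + (e + d)) e
coprime-double+ c = coprime-+ (coprime-+ c)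

odd-coprime-2 : ∀ j → Coprime 2 (suc (2 * j))
odd-coprime-2 j {zero} (0∣2 , _) with () ← 0∣⇒≡0 0∣2
odd-coprime-2 j {1} _ = refl
odd-coprime-2 j {2} (_ , divides i e) = ⊥-elim (even≢odd i j (trans (*-comm 2 i) (sym e)))
odd-coprime-2 j {suc (suc (suc d))} (d∣2 , _) with s≤s (s≤s ()) ← ∣⇒≤ d∣2

odd-coprime-4 : ∀ j → Coprime 4 (suc (2 * j))
odd-coprime-4 j (d∣4 , d∣u) = odd-coprime-2 j (coprime-factors (odd-coprime-2 j) (d∣4 , ∣m⇒∣m*n 2 d∣u) , d∣u)

data Mod4View : ℕ → Set where
  odd    : ∀ e → Mod4View (suc (2 * e))
  4*     : ∀ h → Mod4View (4 * h)
  2+4*   : ∀ h → Mod4View (2 + 4 * h)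

mod4View : ∀ n → Mod4View n
mod4View 0 = 4* 0
mod4View 1 = odd 0
mod4View 2 = 2+4* 0
mod4View 3 = odd 1
mod4View (suc (suc (suc (suc n)))) with mod4View n
... | odd e  = subst Mod4View (lemma e) (odd (2 + e))
  where lemma : ∀ e → suc (2 * (2 + e)) ≡ 4 + suc (2 * e)
        lemma = solve-∀
... | 4* h   = subst Mod4View (lemma h) (4* (suc h))
  where lemma : ∀ h → 4 * suc h ≡ 4 + 4 * h
        lemma = solve-∀
... | 2+4* h = subst Mod4View (lemma h) (2+4* (suc h))
  where lemma : ∀ h → 2 + 4 * suc h ≡ 4 + (2 + 4 * h)
        lemma = solve-∀

-- Removing a loop c^k with 2c < q subtracts c from W, so it makes W a unit if W ≡ u + c.
UnitWithinHalf : (q : ℕ) .{{_ : NonZero q}} → ℕ → Set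
UnitWithinHalf q r = ∃₂ λ u c → Coprime q u × 2 * c < q × (u + c) % q ≡ r

unit-below : ∀ {q u r} .{{_ : NonZero q}} → Coprime q u → 2 * u ≤ 2 * r → 2 * r < q + 2 * u → r < q →
             UnitWithinHalf q r
unit-below {q} {u} {r} coprime 2u≤2r 2r<q+2u r<q = u , r ∸ u , coprime , 2c<q , (begin
  (u + (r ∸ u)) % q ≡⟨ cong (_% q) (m+[n∸m]≡n u≤r) ⟩
  r % q             ≡⟨ m<n⇒m%n≡m r<q ⟩
  r                 ∎)
  where
  open ≡-Reasoning
  u≤r : u ≤ r
  u≤r = *-cancelˡ-≤ 2 2u≤2r
  2c<q : 2 * (r ∸ u) < q
  2c<q = subst (_< q) (sym (*-distribˡ-∸ 2 r u))
           (m<n+o⇒m∸n<o (2 * r) (2 * u) (subst (2 * r <_) (+-comm q (2 * u)) 2r<q+2u))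

unit-near-half : ∀ {q u r} .{{_ : NonZero q}} t → Coprime q u → 2 * u ≤ q + 2 → q < 2 * u + 2 * t →
                 q + 2 ≤ 2 * r → r + t ≤ q → r < q → UnitWithinHalf q r
unit-near-half {q} {u} {r} t coprime 2u≤q+2 q<2u+2t q+2≤2r r+t≤q r<q =
  unit-below coprime (≤-trans 2u≤q+2 q+2≤2r) (+-cancelʳ-≤ (2 * t) (suc (2 * r)) (q + 2 * u) (begin
    suc (2 * r) + 2 * t ≡⟨ lemma₁ r t ⟩
    suc (2 * (r + t))   ≤⟨ s≤s (*-monoʳ-≤ 2 r+t≤q) ⟩
    suc (2 * q)         ≡⟨ lemma₂ q ⟩
    q + suc q           ≤⟨ +-monoʳ-≤ q q<2u+2t ⟩
    q + (2 * u + 2 * t) ≡⟨ +-assoc q (2 * u) (2 * t) ⟨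
    q + 2 * u + 2 * t   ∎)) r<q
  where
  open ≤-Reasoning
  lemma₁ : ∀ r t → suc (2 * r) + 2 * t ≡ suc (2 * (r + t))
  lemma₁ = solve-∀
  lemma₂ : ∀ q → suc (2 * q) ≡ q + suc q
  lemma₂ = solve-∀

middle-odd : ∀ e {r} → suc (2 * e) + 2 ≤ 2 * r → r + 2 ≤ suc (2 * e) → UnitWithinHalf (suc (2 * e)) r
middle-odd e {r} q+2≤2r r+2≤q =
  unit-near-half 2 (subst (λ x → Coprime x e) (q≡ e) (coprime-double+ (1-coprimeTo e)))
    (m+k≡n⇒m≤n 3 (2u≤ e)) (m+k≡n⇒m≤n 2 (q< e)) q+2≤2r r+2≤q (<-≤-trans (m<m+n r {2} z<s) r+2≤q)
  where
  q≡ : ∀ e → e + (e + 1) ≡ suc (2 * e)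
  q≡ = solve-∀
  2u≤ : ∀ e → 2 * e + 3 ≡ suc (2 * e) + 2
  2u≤ = solve-∀
  q< : ∀ e → suc (suc (2 * e)) + 2 ≡ 2 * e + 2 * 2
  q< = solve-∀

middle-4* : ∀ h {r} → 4 * suc h + 2 ≤ 2 * r → r + 2 ≤ 4 * suc h → UnitWithinHalf (4 * suc h) r
middle-4* h {r} q+2≤2r r+2≤q =
  unit-near-half 2 (subst (λ x → Coprime x (suc (2 * h))) (q≡ h) (coprime-double+ (odd-coprime-2 h)))
    (m+k≡n⇒m≤n 4 (2u≤ h)) (m+k≡n⇒m≤n 1 (q< h)) q+2≤2r r+2≤q (<-≤-trans (m<m+n r {2} z<s) r+2≤q)
  where
  q≡ : ∀ h → suc (2 * h) + (suc (2 * h) + 2) ≡ 4 * suc h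
  q≡ = solve-∀
  2u≤ : ∀ h → 2 * suc (2 * h) + 4 ≡ 4 * suc h + 2
  2u≤ = solve-∀
  q< : ∀ h → suc (4 * suc h) + 1 ≡ 2 * suc (2 * h) + 2 * 2
  q< = solve-∀

middle-2+4* : ∀ h {r} → 2 + 4 * suc h + 2 ≤ 2 * r → r + 3 ≤ 2 + 4 * suc h → UnitWithinHalf (2 + 4 * suc h) r
middle-2+4* h {r} q+2≤2r r+3≤q =
  unit-near-half 3 (subst (λ x → Coprime x (suc (2 * h))) (q≡ h) (coprime-double+ (odd-coprime-4 h)))
    (m+k≡n⇒m≤n 6 (2u≤ h)) (m+k≡n⇒m≤n 1 (q< h)) q+2≤2r r+3≤q (<-≤-trans (m<m+n r {3} z<s) r+3≤q)
  where
  q≡ : ∀ h → suc (2 * h) + (suc (2 * h) + 4) ≡ 2 + 4 * suc h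
  q≡ = solve-∀
  2u≤ : ∀ h → 2 * suc (2 * h) + 6 ≡ 2 + 4 * suc h + 2
  2u≤ = solve-∀
  q< : ∀ h → suc (2 + 4 * suc h) + 1 ≡ 2 * suc (2 * h) + 2 * 3
  q< = solve-∀

-- for r = q - 2 the unit q/2 - 2 is out of reach, and its negative q/2 + 2 is used
top-2+4* : ∀ h → UnitWithinHalf (2 + 4 * suc (suc h)) (4 * suc (suc h))
top-2+4* h =
  unit-below (subst (λ x → Coprime x (u + 4)) (q≡ h) (coprime-+ (Coprime.sym (coprime-+ (odd-coprime-4 (suc h))))))
    (m+k≡n⇒m≤n (2 + 4 * h) (2u≤ h)) (m+k≡n⇒m≤n 7 (2r< h)) (m<n+m _ {2} z<s)
  where
  u = suc (2 * suc h)
  q≡ : ∀ h → suc (2 * suc h) + 4 + suc (2 * suc h) ≡ 2 + 4 * suc (suc h)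
  q≡ = solve-∀
  2u≤ : ∀ h → 2 * (suc (2 * suc h) + 4) + (2 + 4 * h) ≡ 2 * (4 * suc (suc h))
  2u≤ = solve-∀
  2r< : ∀ h → suc (2 * (4 * suc (suc h))) + 7 ≡ 2 + 4 * suc (suc h) + 2 * (suc (2 * suc h) + 4)
  2r< = solve-∀

unit-in-middle : ∀ q {r} .{{_ : NonZero q}} → 3 ≤ q → q + 2 ≤ 2 * r → r + 2 ≤ q → ¬ (q ≡ 6 × r ≡ 4) →
                 UnitWithinHalf q r
unit-in-middle q {r} 3≤q q+2≤2r r+2≤q q,r≢6,4 with mod4View q
... | odd e        = middle-odd e q+2≤2r r+2≤q
... | 4* zero      = contradiction 3≤q λ ()
... | 4* (suc h)   = middle-4* h q+2≤2r r+2≤q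
... | 2+4* zero    = contradiction 3≤q λ { (s≤s (s≤s ())) }
... | 2+4* (suc h) with m≤n⇒m<n∨m≡n r+2≤q
...   | inj₁ r+2<q = middle-2+4* h q+2≤2r (subst (_≤ 2 + 4 * suc h) (sym (+-suc r 2)) r+2<q)
...   | inj₂ r+2≡q with h
...     | zero    = contradiction (refl , +-cancelʳ-≡ 2 r 4 r+2≡q) q,r≢6,4
...     | suc h′  = subst (UnitWithinHalf _) (sym (+-cancelʳ-≡ 2 r _ (trans r+2≡q (+-comm 2 _)))) (top-2+4* h′)

coprime-pred : ∀ {q} → 1 ≤ q → Coprime q (q ∸ 1)
coprime-pred {q} 1≤q = subst (λ x → Coprime x (q ∸ 1)) (m∸n+n≡m 1≤q) (coprime-+ (1-coprimeTo (q ∸ 1)))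

unit-within-half : ∀ q .{{_ : NonZero q}} → 3 ≤ q → ∀ r → r < q → ¬ (q ≡ 6 × r ≡ 4) → UnitWithinHalf q r
unit-within-half q 3≤q zero _ _ =
  q ∸ 1 , 1 , coprime-pred 1≤q , 3≤q , trans (cong (_% q) (m∸n+n≡m 1≤q)) (n%n≡0 q)
  where
  1≤q : 1 ≤ q
  1≤q = ≤-trans (s≤s z≤n) 3≤q
unit-within-half q 3≤q (suc r) r<q q,r≢6,4 with 2 * r <? q
... | yes 2r<q = 1 , r , Coprime.sym (1-coprimeTo q) , 2r<q , m<n⇒m%n≡m r<q
... | no 2r≮q with m≤n⇒m<n∨m≡n r<q
...   | inj₂ refl = suc r , 0 , coprime-pred (s≤s z≤n) , z<s , trans (cong (_% q) (+-identityʳ (suc r))) (m<n⇒m%n≡m r<q)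
...   | inj₁ r+2<q = unit-in-middle q 3≤q q+2≤2r (subst (_≤ q) (+-comm 2 (suc r)) r+2<q) q,r≢6,4
  where
  q+2≤2r : q + 2 ≤ 2 * suc r
  q+2≤2r = ≤-trans (+-monoˡ-≤ 2 (≮⇒≥ 2r≮q)) (≤-reflexive (lemma r))
    where lemma : ∀ r → 2 * r + 2 ≡ 2 * suc r
          lemma = solve-∀

-- Cycles in the de Bruijn graph

module DeBruijn {A : Set} (_≟_ : DecidableEquality A) (k : ℕ) where

  Word : Set
  Word = Vec A (suc k)

  infix 4 _⇒_
  record _⇒_ (x y : Word) : Set where
    constructor edge
    field
      {letter} : A
      shifted  : y ≡ tail x ∷ʳ letter

  ⇒-resp-tail : ∀ {x x' y} → tail x ≡ tail x' → x ⇒ y → x' ⇒ y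
  ⇒-resp-tail tx≡tx' (edge refl) = edge (cong (_∷ʳ _) tx≡tx')

  Path : Word → List Word → Word → Set
  Path x []       y = x ⇒ y
  Path x (z ∷ zs) y = x ⇒ z × Path z zs y

  path-++ : ∀ {x y z} ps {qs} → Path x ps y → Path y qs z → Path x (ps ++ y ∷ qs) z
  path-++ []       x⇒y      q = x⇒y , q
  path-++ (_ ∷ ps) (x⇒ , p) q = x⇒ , path-++ ps p q

  path-split : ∀ {x y z} ps {qs} → Path x (ps ++ y ∷ qs) z → Path x ps y × Path y qs z
  path-split []       p        = p
  path-split (_ ∷ ps) (x⇒ , p) = let p₁ , p₂ = path-split ps p in (x⇒ , p₁) , p₂

  path-resp-tail : ∀ {x x' y} zs → tail x ≡ tail x' → Path x zs y → Path x' zs y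
  path-resp-tail []      tx≡tx' x⇒y      = ⇒-resp-tail tx≡tx' x⇒y
  path-resp-tail (_ ∷ _) tx≡tx' (x⇒ , p) = ⇒-resp-tail tx≡tx' x⇒ , p

  path-resp-end : ∀ {x y y'} zs → (∀ {ℓ} → ℓ ⇒ y → ℓ ⇒ y') → Path x zs y → Path x zs y'
  path-resp-end []       f ℓ⇒y      = f ℓ⇒y
  path-resp-end (_ ∷ zs) f (x⇒ , p) = x⇒ , path-resp-end zs f p

  record Cycle : Set where
    constructor cycle
    field
      start    : Word
      rest     : List Word
      closed   : Path start rest start
      distinct : Unique (start ∷ rest)

  vertices : Cycle → List Word
  vertices C = Cycle.start C ∷ Cycle.rest C

  restart : ∀ C {y} → y ∈ vertices C → ∃ λ ys → Path y ys y × vertices C ↭ y ∷ ys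
  restart (cycle x xs p _) (here refl) = xs , p , ↭-refl
  restart (cycle x xs p _) (there y∈xs) with ∈-∃++ y∈xs
  ... | P , Q , refl = let p₁ , p₂ = path-split P p in Q ++ x ∷ P , path-++ Q p₂ p₁ , ↭-++-comm (x ∷ P) (_ ∷ Q)

  rot : Word → Word
  rot (c ∷ w) = w ∷ʳ c

  ⇒rot : ∀ v → v ⇒ rot v
  ⇒rot (c ∷ w) = edge refl

  rotate : ℕ → Word → Word
  rotate i v = iterate rot v i

  rotate-+ : ∀ i j v → rotate (i + j) v ≡ rotate j (rotate i v)
  rotate-+ zero    j v = refl
  rotate-+ (suc i) j v = rotate-+ i j (rot v)

  rot-rotate : ∀ i v → rot (rotate i v) ≡ rotate (suc i) v
  rot-rotate i v = trans (sym (rotate-+ i 1 v)) (cong (λ n → rotate n v) (+-comm i 1))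

  toList-rotate : ∀ i v → toList (rotate i v) ≡ iterate rotl (toList v) i
  toList-rotate zero    v       = refl
  toList-rotate (suc i) (c ∷ w) = trans (toList-rotate i (w ∷ʳ c)) (cong (λ l → iterate rotl l i) (toList-∷ʳ c w))

  rotate-period : ∀ v → rotate (suc k) v ≡ v
  rotate-period v = trans (sym (cast-is-id refl _)) (toList-injective refl _ v (begin
    toList (rotate (suc k) v)                       ≡⟨ toList-rotate (suc k) v ⟩
    iterate rotl (toList v) (suc k)                 ≡⟨ cong (iterate rotl (toList v)) (length-toList v) ⟨
    iterate rotl (toList v) (length (toList v))     ≡⟨ cong (λ l → iterate rotl l (length (toList v))) (++-identityʳ (toList v)) ⟨
    iterate rotl (toList v ++ []) (length (toList v)) ≡⟨ rotl-++ (toList v) [] ⟩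
    toList v                                        ∎))
    where open ≡-Reasoning

  rotate-inverse : ∀ i v → rotate (i * k) (rotate i v) ≡ v
  rotate-inverse i v = trans (sym (rotate-+ i (i * k) v)) (trans (cong (λ n → rotate n v) (sym (*-suc i k))) (multiple i))
    where
    multiple : ∀ m → rotate (m * suc k) v ≡ v
    multiple zero    = refl
    multiple (suc m) = trans (rotate-+ (suc k) (m * suc k) v) (trans (cong (rotate (m * suc k)) (rotate-period v)) (multiple m))

  RotationClosed : List Word → Set
  RotationClosed L = ∀ {z} → z ∈ L → rot z ∈ L

  rotate-∈ : ∀ {L} → RotationClosed L → ∀ i {z} → z ∈ L → rotate i z ∈ L
  rotate-∈ closed zero    z∈L = z∈L
  rotate-∈ closed (suc i) z∈L = rotate-∈ closed i (closed z∈L)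

  orbit : Word → ℕ → List Word
  orbit v p = applyUpTo (λ i → rotate i v) p

  path-orbit : ∀ {x v} p → x ⇒ v → Path x (orbit v p) (rotate p v)
  path-orbit zero            x⇒v = x⇒v
  path-orbit {v = v} (suc p) x⇒v = x⇒v , path-orbit p (⇒rot v)

  minimal-period : ∀ v → ∃ λ p → rotate (suc p) v ≡ v × (∀ {d} → 0 < d → d ≤ p → rotate d v ≢ v)
  minimal-period v with least-witness {P = λ i → rotate (suc i) v ≡ v} (λ i → ≡-dec _≟_ (rotate (suc i) v) v) {k} (rotate-period v)
  ... | p , _ , period , below = p , period , λ { {suc d} _ d≤p → below d≤p }

  module _ {v p} (period : rotate (suc p) v ≡ v) where

    orbit-unique : (∀ {d} → 0 < d → d ≤ p → rotate d v ≢ v) → Unique (orbit v (suc p))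
    orbit-unique minimal = applyUpTo⁺₁ (λ i → rotate i v) (suc p) distinct
      where
      distinct : ∀ {i j} → i < j → j < suc p → rotate i v ≢ rotate j v
      distinct {i} {j} i<j j<p eq = minimal (≤-trans (m<n⇒0<n∸m j<p) (m≤n+m _ i))
        (s≤s⁻¹ (≤-trans (+-monoˡ-< (suc p ∸ j) i<j) (≤-reflexive (m+[n∸m]≡n (<⇒≤ j<p))))) (begin
        rotate (i + (suc p ∸ j)) v      ≡⟨ rotate-+ i (suc p ∸ j) v ⟩
        rotate (suc p ∸ j) (rotate i v) ≡⟨ cong (rotate (suc p ∸ j)) eq ⟩
        rotate (suc p ∸ j) (rotate j v) ≡⟨ rotate-+ j (suc p ∸ j) v ⟨
        rotate (j + (suc p ∸ j)) v      ≡⟨ cong (λ n → rotate n v) (m+[n∸m]≡n (<⇒≤ j<p)) ⟩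
        rotate (suc p) v                ≡⟨ period ⟩
        v                               ∎)
        where open ≡-Reasoning

    orbit-closed : RotationClosed (orbit v (suc p))
    orbit-closed z∈ with ∈-applyUpTo⁻ (λ i → rotate i v) z∈
    ... | i , i<p , refl with m≤n⇒m<n∨m≡n i<p
    ...   | inj₁ i+1<p = subst (_∈ orbit v (suc p)) (sym (rot-rotate i v)) (∈-applyUpTo⁺ (λ i → rotate i v) i+1<p)
    ...   | inj₂ refl  = subst (_∈ orbit v (suc p)) (sym (trans (rot-rotate p v) period)) (here refl)

  join : ∀ C {y v} → y ∈ vertices C → tail v ≡ tail y → (∀ i → rotate i v ∉ vertices C) →
         Σ Cycle λ C' → vertices C ⊆ vertices C' × (∀ i → rotate i v ∈ vertices C') ×
                        (∀ {z} → z ∈ vertices C' → z ∈ vertices C ⊎ ∃ λ i → z ≡ rotate i v)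
  join C {y} {v} y∈C tv≡ty disjoint with restart C y∈C | minimal-period v
  ... | ys , y-path , C↭y∷ys | p , period , minimal =
    cycle v (ys ++ y ∷ D) closed distinct ,
    (λ z∈C → ∈-resp-↭ (↭-sym ↭O++C) (∈-++⁺ʳ O z∈C)) ,
    (λ i → ∈-resp-↭ (↭-sym ↭O++C) (∈-++⁺ˡ {ys = vertices C} (rotate-∈ (orbit-closed period) i (here refl)))) ,
    λ z∈C' → Data.Sum.map₂ (λ z∈O → let i , _ , z≡ = ∈-applyUpTo⁻ (λ i → rotate i v) z∈O in i , z≡)
                             (Data.Sum.swap (∈-++⁻ O (∈-resp-↭ ↭O++C z∈C')))
    where
    O = orbit v (suc p)
    D = orbit (rot v) p
    closed : Path v (ys ++ y ∷ D) v
    closed = path-++ ys (path-resp-tail ys (sym tv≡ty) y-path)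
               (subst (Path y D) period (path-orbit p (⇒-resp-tail tv≡ty (⇒rot v))))
    ↭O++C : v ∷ ys ++ y ∷ D ↭ O ++ vertices C
    ↭O++C = prep v (↭-trans (shift y ys D) (↭-trans (↭-++-comm (y ∷ ys) D) (↭-++⁺ˡ D (↭-sym C↭y∷ys))))
    distinct : Unique (v ∷ ys ++ y ∷ D)
    distinct = Unique-resp-↭ (↭-sym ↭O++C) (++⁺ (orbit-unique period minimal) (Cycle.distinct C)
      λ (z∈O , z∈C) → let i , _ , z≡ = ∈-applyUpTo⁻ (λ i → rotate i v) z∈O in disjoint i (subst (_∈ vertices C) z≡ z∈C))

  replicate-∷ʳ : ∀ n (c : A) → replicate n c ∷ʳ c ≡ replicate (suc n) c
  replicate-∷ʳ zero    c = refl
  replicate-∷ʳ (suc n) c = cong (c ∷_) (replicate-∷ʳ n c)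

  loop : ∀ c → replicate (suc k) c ⇒ replicate (suc k) c
  loop c = edge (sym (replicate-∷ʳ k c))

  weigh-rot : ∀ μ v → weigh μ (rot v) ≡ weigh μ v
  weigh-rot μ (c ∷ w) = trans (weigh-∷ʳ μ w c) (+-comm _ (μ c))

  weigh-rotate : ∀ μ i v → weigh μ (rotate i v) ≡ weigh μ v
  weigh-rotate μ zero    v = refl
  weigh-rotate μ (suc i) v = trans (weigh-rotate μ i (rot v)) (weigh-rot μ v)

  _≟ʷ_ : DecidableEquality Word
  _≟ʷ_ = ≡-dec _≟_

  module Covering (a : A) (P : Pred Word 0ℓ)
                  (P-rot : ∀ {v} → P v → P (rot v)) (P-lower : ∀ {v} → P v → P (a ∷ tail v))
                  (P-const : P (replicate (suc k) a)) where

    defect : A → ℕ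
    defect c with c ≟ a
    ... | yes _ = 0
    ... | no  _ = 1

    lowering-reduces-defects : ∀ (v : Word) → head v ≢ a → weigh defect (a ∷ tail v) < weigh defect v
    lowering-reduces-defects (c ∷ w) c≢a with a ≟ a | c ≟ a
    ... | no a≢a | _       = contradiction refl a≢a
    ... | _      | yes c≡a = contradiction c≡a c≢a
    ... | yes _  | no _    = ≤-refl

    P-rotate : ∀ i {v} → P v → P (rotate i v)
    P-rotate zero    Pv = Pv
    P-rotate (suc i) Pv = P-rotate i (P-rot Pv)

    defective-rotation : ∀ v → v ≢ replicate (suc k) a → ∃ λ i → head (rotate i v) ≢ a
    defective-rotation v v≢aᵏ with first-failure (_≟ a) (toList v)
    ... | inj₁ all-a = contradiction (all-a⇒replicate v all-a) v≢aᵏ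
      where
      all-a⇒replicate : ∀ {n} (w : Vec A n) → All (_≡ a) (toList w) → w ≡ replicate n a
      all-a⇒replicate []      []           = refl
      all-a⇒replicate (_ ∷ w) (refl ∷ all) = cong (a ∷_) (all-a⇒replicate w all)
    ... | inj₂ (xs , ys , c , v≡ , c≢a) = length xs , λ h≡a → c≢a (trans (sym (head≡ (rotate (length xs) v) rotated)) h≡a)
      where
      rotated : toList (rotate (length xs) v) ≡ c ∷ ys ++ xs
      rotated = trans (toList-rotate (length xs) v) (trans (cong (λ l → iterate rotl l (length xs)) v≡) (rotl-++ xs (c ∷ ys)))
      head≡ : ∀ {n} (w : Vec A (suc n)) {c cs} → toList w ≡ c ∷ cs → head w ≡ c
      head≡ (_ ∷ _) eq = Listₚ.∷-injectiveˡ eq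

    Good : Cycle → Set
    Good C = (∀ {z} → z ∈ vertices C → P z) × RotationClosed (vertices C) × replicate (suc k) a ∈ vertices C

    join-class : ∀ C {v} i → Good C → a ∷ tail (rotate i v) ∈ vertices C → P v → v ∉ vertices C →
                 Σ Cycle λ C' → Good C' × vertices C ⊆ vertices C' × v ∈ vertices C'
    join-class C {v} i (P-C , closed , aᵏ∈C) y∈C Pv v∉C with join C y∈C refl disjoint
      where
      disjoint : ∀ j → rotate j (rotate i v) ∉ vertices C
      disjoint j v'ʲ∈C = v∉C (subst (_∈ vertices C) (rotate-inverse (i + j) v)
        (rotate-∈ closed ((i + j) * k) (subst (_∈ vertices C) (sym (rotate-+ i j v)) v'ʲ∈C)))
    ... | C' , C⊆C' , rotations∈C' , C'⊆ = C' , (P-C' , closed' , C⊆C' aᵏ∈C) , C⊆C' ,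
                                            subst (_∈ vertices C') (rotate-inverse i v) (rotations∈C' (i * k))
      where
      P-C' : ∀ {z} → z ∈ vertices C' → P z
      P-C' z∈C' with C'⊆ z∈C'
      ... | inj₁ z∈C        = P-C z∈C
      ... | inj₂ (j , refl) = P-rotate j (P-rotate i Pv)
      closed' : RotationClosed (vertices C')
      closed' z∈C' with C'⊆ z∈C'
      ... | inj₁ z∈C        = C⊆C' (closed z∈C)
      ... | inj₂ (j , refl) = subst (_∈ vertices C') (sym (rot-rotate j (rotate i v))) (rotations∈C' (suc j))

    -- v is spliced in next to a ∷ tail v′ for a rotation v′ of v with head v′ ≢ a; that word has one
    -- letter ≢ a fewer, so it is added first
    grow : ∀ v → Acc _<_ (weigh defect v) → P v → ∀ C → Good C →
           Σ Cycle λ C' → Good C' × vertices C ⊆ vertices C' × v ∈ vertices C'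
    grow v (acc smaller) Pv C good@(_ , _ , aᵏ∈C) with ∈? _≟ʷ_ v (vertices C)
    ... | yes v∈C = C , good , id , v∈C
    ... | no v∉C with defective-rotation v (λ { refl → v∉C aᵏ∈C })
    ...   | i , head≢a with grow (a ∷ tail (rotate i v)) (smaller fewer-defects) (P-lower (P-rotate i Pv)) C good
      where
      fewer-defects : weigh defect (a ∷ tail (rotate i v)) < weigh defect v
      fewer-defects = subst (weigh defect (a ∷ tail (rotate i v)) <_) (weigh-rotate defect i v)
                        (lowering-reduces-defects (rotate i v) head≢a)
    ...     | C₁ , good₁ , C⊆C₁ , y∈C₁ with ∈? _≟ʷ_ v (vertices C₁)
    ...       | yes v∈C₁ = C₁ , good₁ , C⊆C₁ , v∈C₁
    ...       | no v∉C₁ = let C₂ , good₂ , C₁⊆C₂ , v∈C₂ = join-class C₁ i good₁ y∈C₁ Pv v∉C₁ in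
                           C₂ , good₂ , C₁⊆C₂ ∘ C⊆C₁ , v∈C₂

    good-cycle-through : ∀ ws → (∀ {w} → w ∈ ws → P w) → Σ Cycle λ C → Good C × ws ⊆ vertices C
    good-cycle-through [] _ = cycle aᵏ [] (loop a) ([] ∷ []) ,
      ((λ { (here refl) → P-const }) , (λ { (here refl) → here (replicate-∷ʳ k a) }) , here refl) , λ ()
      where aᵏ = replicate (suc k) a
    good-cycle-through (w ∷ ws) Pws with good-cycle-through ws (Pws ∘ there)
    ... | C , good , ws⊆C with grow w (<-wellFounded _) (Pws (here refl)) C good
    ...   | C' , good' , C⊆C' , w∈C' = C' , good' , λ { (here refl) → w∈C' ; (there w∈ws) → C⊆C' (ws⊆C w∈ws) }

  remove-loop : ∀ C {c v} → replicate (suc k) c ∈ vertices C → v ∈ vertices C → v ≢ replicate (suc k) c →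
                Σ Cycle λ C' → vertices C ↭ replicate (suc k) c ∷ vertices C'
  remove-loop C {c} cᵏ∈C v∈C v≢cᵏ with restart C cᵏ∈C
  ... | [] , _ , C↭[cᵏ] = contradiction (∈-resp-↭ C↭[cᵏ] v∈C) λ { (here v≡cᵏ) → v≢cᵏ v≡cᵏ }
  ... | w ∷ ws , (cᵏ⇒w , w-path) , C↭cᵏ∷w∷ws with Unique-resp-↭ C↭cᵏ∷w∷ws (Cycle.distinct C)
  ...   | _ ∷ distinct = cycle w ws (path-resp-end ws bypass w-path) distinct , C↭cᵏ∷w∷ws
    where
    bypass : ∀ {ℓ} → ℓ ⇒ replicate (suc k) c → ℓ ⇒ w
    bypass {ℓ} (edge cᵏ≡) = ⇒-resp-tail (∷ʳ-injectiveˡ (replicate k c) (tail ℓ) (trans (replicate-∷ʳ k c) cᵏ≡)) cᵏ⇒w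

  path-at : ∀ {x y} zs → Path x zs y → ∀ {d i} → i ≤ length zs → at d (x ∷ zs) i ⇒ at d (zs ++ [ y ]) i
  path-at []       x⇒y       {i = zero}  _   = x⇒y
  path-at (_ ∷ zs) (x⇒z , _) {i = zero}  _   = x⇒z
  path-at (_ ∷ zs) (_ , p)   {i = suc i} i≤n = path-at zs p (s≤s⁻¹ i≤n)

  module _ (C : Cycle) where
    open Cycle C

    period : ℕ
    period = length (vertices C)

    walk : ℕ → Word
    walk i = at start (vertices C) (i % period)

    walk-⇒ : ∀ i → walk i ⇒ walk (suc i)
    walk-⇒ i = subst (walk i ⇒_) next≡ (path-at rest closed (s≤s⁻¹ (m%n<n i period)))
      where
      next≡ : at start (rest ++ [ start ]) (i % period) ≡ walk (suc i)
      next≡ with m≤n⇒m<n∨m≡n (m%n<n i period)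
      ... | inj₁ i%p+1<p = trans (at-++ˡ rest (s≤s⁻¹ i%p+1<p))
                                 (cong (at start (vertices C)) (sym (trans (suc-% i period) (m<n⇒m%n≡m i%p+1<p))))
      ... | inj₂ i%p+1≡p = trans (cong (at start (rest ++ [ start ])) (suc-injective i%p+1≡p))
                           (trans (at-∷ʳ rest) (cong (at start (vertices C))
                             (sym (trans (suc-% i period) (trans (cong (_% period) i%p+1≡p) (n%n≡0 period))))))

    walk-periodic : ∀ i → walk (i + period) ≡ walk i
    walk-periodic i = cong (at start (vertices C)) ([m+n]%n≡m%n i period)

    walk-∈ : ∀ i → walk i ∈ vertices C
    walk-∈ i = at-∈ (vertices C) (m%n<n i period)

    walk-injective : ∀ {i j} → walk i ≡ walk j → i % period ≡ j % period
    walk-injective {i} {j} = at-injective distinct (m%n<n i period) (m%n<n j period)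

    applyUpTo-walk : applyUpTo walk period ≡ vertices C
    applyUpTo-walk = trans (applyUpTo-cong period (λ i<p → cong (at start (vertices C)) (m<n⇒m%n≡m i<p)))
                           (applyUpTo-at (vertices C))

-- Sequences from walks, and their integrals

module _ {q : ℕ} (k : ℕ) where
  open DeBruijn (Fin._≟_ {q}) k

  -- by induction on n = toℕ j, since the recursive call is at inject₁ j
  lookup-walk : (w : ℕ → Word) → (∀ i → w i ⇒ w (suc i)) →
                ∀ n i (j : Fin (suc k)) → toℕ j ≡ n → lookup (w i) j ≡ head (w (i + n))
  lookup-walk w step _ i zero refl = trans (lookup-zero (w i)) (cong (head ∘ w) (sym (+-identityʳ i)))
    where
    lookup-zero : ∀ {n} (v : Vec (Fin q) (suc n)) → lookup v zero ≡ head v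
    lookup-zero (_ ∷ _) = refl
  lookup-walk w step (suc n) i (suc j) j+1≡n+1 with step i
  ... | edge shifted = begin
    lookup (w i) (suc j)                       ≡⟨ lookup-suc (w i) j ⟩
    lookup (tail (w i)) j                      ≡⟨ lookup-∷ʳ-inject₁ (tail (w i)) j ⟨
    lookup (tail (w i) ∷ʳ _) (inject₁ j)       ≡⟨ cong (λ v → lookup v (inject₁ j)) shifted ⟨
    lookup (w (suc i)) (inject₁ j)             ≡⟨ lookup-walk w step n (suc i) (inject₁ j)
                                                    (trans (toℕ-inject₁ j) (suc-injective j+1≡n+1)) ⟩
    head (w (suc i + n))                       ≡⟨ cong (head ∘ w) (+-suc i n) ⟨
    head (w (i + suc n))                       ∎
    where
    open ≡-Reasoning
    lookup-suc : ∀ {n} (v : Vec (Fin q) (suc n)) j → lookup v (suc j) ≡ lookup (tail v) j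
    lookup-suc (_ ∷ _) j = refl
    lookup-∷ʳ-inject₁ : ∀ {n} (v : Vec (Fin q) n) {x} j → lookup (v ∷ʳ x) (inject₁ j) ≡ lookup v j
    lookup-∷ʳ-inject₁ (_ ∷ _) zero    = refl
    lookup-∷ʳ-inject₁ (_ ∷ v) (suc j) = lookup-∷ʳ-inject₁ v j

  walk-windows : (w : ℕ → Word) → (∀ i → w i ⇒ w (suc i)) → ∀ i → window (suc k) (head ∘ w) i ≡ w i
  walk-windows w step i = trans (tabulate-cong (λ j → sym (lookup-walk w step (toℕ j) i j refl))) (tabulate∘lookup (w i))

  cycle-windows : ∀ C i → window (suc k) (head ∘ walk C) i ≡ walk C i
  cycle-windows C = walk-windows (walk C) (walk-⇒ C)

  cycle-periodic : ∀ C → Periodic (period C) (head ∘ walk C)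
  cycle-periodic C i = cong head (walk-periodic C i)

  cycle-windowSeq : ∀ C → IsWindowSeq (suc k) (period C) (head ∘ walk C)
  cycle-windowSeq C i j eq =
    ∣∣-∣⇒[mod] i j (%≡%⇒∣∣-∣ i j (walk-injective C {i} {j} (trans (sym (cycle-windows C i)) (trans eq (cycle-windows C j)))))

partialSum : (ℕ → ℕ) → ℕ → ℕ
partialSum f n = sum (applyUpTo f n)

partialSum-suc : ∀ f n → partialSum f (suc n) ≡ partialSum f n + f n
partialSum-suc f n = begin
  sum (applyUpTo f (suc n))     ≡⟨ cong sum (applyUpTo-∷ʳ f n) ⟨
  sum (applyUpTo f n ++ [ f n ]) ≡⟨ sum-++ (applyUpTo f n) [ f n ] ⟩
  partialSum f n + (f n + 0)    ≡⟨ cong (_+_ (partialSum f n)) (+-identityʳ (f n)) ⟩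
  partialSum f n + f n          ∎
  where open ≡-Reasoning

module _ {f : ℕ → ℕ} {m : ℕ} (periodic : ∀ i → f (i + m) ≡ f i) where

  partialSum-+period : ∀ i → partialSum f (i + m) ≡ partialSum f i + partialSum f m
  partialSum-+period zero    = refl
  partialSum-+period (suc i) = begin
    partialSum f (suc (i + m))                ≡⟨ partialSum-suc f (i + m) ⟩
    partialSum f (i + m) + f (i + m)          ≡⟨ cong₂ _+_ (partialSum-+period i) (periodic i) ⟩
    partialSum f i + partialSum f m + f i     ≡⟨ lemma (partialSum f i) (partialSum f m) (f i) ⟩
    (partialSum f i + f i) + partialSum f m   ≡⟨ cong (_+ partialSum f m) (partialSum-suc f i) ⟨
    partialSum f (suc i) + partialSum f m     ∎
    where open ≡-Reasoning
          lemma : ∀ a b c → a + b + c ≡ a + c + b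
          lemma = solve-∀

  partialSum-+periods : ∀ d i → partialSum f (i + d * m) ≡ partialSum f i + d * partialSum f m
  partialSum-+periods zero    i = trans (cong (partialSum f) (+-identityʳ i)) (sym (+-identityʳ _))
  partialSum-+periods (suc d) i = begin
    partialSum f (i + (m + d * m))                ≡⟨ cong (partialSum f) (lemma₁ i m (d * m)) ⟩
    partialSum f (i + d * m + m)                  ≡⟨ partialSum-+period (i + d * m) ⟩
    partialSum f (i + d * m) + partialSum f m     ≡⟨ cong (_+ partialSum f m) (partialSum-+periods d i) ⟩
    partialSum f i + d * partialSum f m + partialSum f m ≡⟨ lemma₂ (partialSum f i) d (partialSum f m) ⟩
    partialSum f i + suc d * partialSum f m       ∎
    where open ≡-Reasoning
          lemma₁ : ∀ a b c → a + (b + c) ≡ a + c + b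
          lemma₁ = solve-∀
          lemma₂ : ∀ a d b → a + d * b + b ≡ a + suc d * b
          lemma₂ = solve-∀

module _ {q : ℕ} .{{_ : NonZero q}} where

  infixl 6 _-ᶠ_
  _-ᶠ_ : Fin q → Fin q → Fin q
  y -ᶠ x = (toℕ y + (q ∸ toℕ x)) mod q

  toℕ-mod : ∀ n → toℕ (n mod q) ≡ n % q
  toℕ-mod n = toℕ-fromℕ< (m%n<n n q)

  [m%q+n]%q≡[m+n]%q : ∀ m n → (m % q + n) % q ≡ (m + n) % q
  [m%q+n]%q≡[m+n]%q m n = begin
    (m % q + n) % q           ≡⟨ %-distribˡ-+ (m % q) n q ⟩
    (m % q % q + n % q) % q   ≡⟨ cong (λ x → (x + n % q) % q) (m%n%n≡m%n m q) ⟩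
    (m % q + n % q) % q       ≡⟨ %-distribˡ-+ m n q ⟨
    (m + n) % q               ∎
    where open ≡-Reasoning

  -ᶠ-antisym : ∀ x y → (toℕ (y -ᶠ x) + toℕ (x -ᶠ y)) % q ≡ 0
  -ᶠ-antisym x y = begin
    (toℕ (y -ᶠ x) + toℕ (x -ᶠ y)) % q                          ≡⟨ cong₂ (λ a b → (a + b) % q) (toℕ-mod _) (toℕ-mod _) ⟩
    ((toℕ y + (q ∸ toℕ x)) % q + (toℕ x + (q ∸ toℕ y)) % q) % q ≡⟨ %-distribˡ-+ (toℕ y + (q ∸ toℕ x)) _ q ⟨
    ((toℕ y + (q ∸ toℕ x)) + (toℕ x + (q ∸ toℕ y))) % q         ≡⟨ cong (_% q) (lemma (toℕ y) (toℕ x) _ _) ⟩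
    ((toℕ x + (q ∸ toℕ x)) + (toℕ y + (q ∸ toℕ y))) % q         ≡⟨ cong₂ (λ a b → (a + b) % q)
                                                                    (m+[n∸m]≡n (<⇒≤ (toℕ<n x))) (m+[n∸m]≡n (<⇒≤ (toℕ<n y))) ⟩
    (q + q) % q                                                 ≡⟨ [m+n]%n≡m%n q q ⟩
    q % q                                                       ≡⟨ n%n≡0 q ⟩
    0                                                           ∎
    where open ≡-Reasoning
          lemma : ∀ a b c d → (a + c) + (b + d) ≡ (b + c) + (a + d)
          lemma = solve-∀

  integrate : (ℕ → Fin q) → ℕ → Fin q
  integrate t i = partialSum (toℕ ∘ t) i mod q

  integrate-difference : ∀ t i → integrate t (suc i) -ᶠ integrate t i ≡ t i
  integrate-difference t i = toℕ-injective (begin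
    toℕ (integrate t (suc i) -ᶠ integrate t i)     ≡⟨ toℕ-mod _ ⟩
    (toℕ (integrate t (suc i)) + (q ∸ toℕ (integrate t i))) % q
                                                    ≡⟨ cong₂ (λ a b → (a + (q ∸ b)) % q) (toℕ-mod _) (toℕ-mod S) ⟩
    (partialSum (toℕ ∘ t) (suc i) % q + (q ∸ S % q)) % q
                                                    ≡⟨ [m%q+n]%q≡[m+n]%q _ (q ∸ S % q) ⟩
    (partialSum (toℕ ∘ t) (suc i) + (q ∸ S % q)) % q ≡⟨ cong (λ a → (a + (q ∸ S % q)) % q) (partialSum-suc (toℕ ∘ t) i) ⟩
    (S + τ + (q ∸ S % q)) % q                       ≡⟨ cong (_% q) (lemma S τ (q ∸ S % q)) ⟩
    (τ + (S + (q ∸ S % q))) % q                     ≡⟨ cong (λ a → (τ + a) % q) S+[q∸S%q]≡ ⟩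
    (τ + suc (S / q) * q) % q                       ≡⟨ [m+kn]%n≡m%n τ (suc (S / q)) q ⟩
    τ % q                                           ≡⟨ m<n⇒m%n≡m (toℕ<n (t i)) ⟩
    τ                                               ∎)
    where
    open ≡-Reasoning
    S = partialSum (toℕ ∘ t) i
    τ = toℕ (t i)
    lemma : ∀ a b c → a + b + c ≡ b + (a + c)
    lemma = solve-∀
    S+[q∸S%q]≡ : S + (q ∸ S % q) ≡ suc (S / q) * q
    S+[q∸S%q]≡ = begin
      S + (q ∸ S % q)                      ≡⟨ cong (_+ (q ∸ S % q)) (m≡m%n+[m/n]*n S q) ⟩
      S % q + S / q * q + (q ∸ S % q)      ≡⟨ lemma (S % q) (S / q * q) (q ∸ S % q) ⟩
      S / q * q + (S % q + (q ∸ S % q))    ≡⟨ cong (_+_ (S / q * q)) (m+[n∸m]≡n (<⇒≤ (m%n<n S q))) ⟩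
      S / q * q + q                        ≡⟨ +-comm (S / q * q) q ⟩
      suc (S / q) * q                      ∎

  integrate-periodic : ∀ {t m} → Periodic m t → Periodic (q * m) (integrate t)
  integrate-periodic {t} {m} periodic i = toℕ-injective (begin
    toℕ (integrate t (i + q * m))       ≡⟨ toℕ-mod (S (i + q * m)) ⟩
    S (i + q * m) % q                   ≡⟨ cong (_% q) (partialSum-+periods (cong toℕ ∘ periodic) q i) ⟩
    (S i + q * S m) % q                 ≡⟨ cong (λ x → (S i + x) % q) (*-comm q (S m)) ⟩
    (S i + S m * q) % q                 ≡⟨ [m+kn]%n≡m%n (S i) (S m) q ⟩
    S i % q                             ≡⟨ toℕ-mod (S i) ⟨
    toℕ (integrate t i)                 ∎)
    where open ≡-Reasoning
          S = partialSum (toℕ ∘ t)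

  differences : ∀ {n} → Vec (Fin q) (suc n) → Vec (Fin q) n
  differences (x ∷ [])    = []
  differences (x ∷ y ∷ v) = (y -ᶠ x) ∷ differences (y ∷ v)

  window-suc : ∀ n (s : ℕ → Fin q) i → window (suc n) s i ≡ s i ∷ window n s (suc i)
  window-suc n s i = cong₂ _∷_ (cong s (+-identityʳ i)) (tabulate-cong (λ j → cong s (+-suc i (toℕ j))))

  differences-window : ∀ t n i → differences (window (suc n) (integrate t) i) ≡ window n t i
  differences-window t zero    i = refl
  differences-window t (suc n) i = begin
    differences (window (suc (suc n)) s i)                   ≡⟨ cong differences (window-suc (suc n) s i) ⟩
    differences (s i ∷ window (suc n) s (suc i))             ≡⟨ cong (λ v → differences (s i ∷ v)) (window-suc n s (suc i)) ⟩
    (s (suc i) -ᶠ s i) ∷ differences (s (suc i) ∷ window n s (suc (suc i)))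
                                                             ≡⟨ cong₂ _∷_ (integrate-difference t i) (trans
                                                                 (cong differences (sym (window-suc n s (suc i))))
                                                                 (differences-window t n (suc i))) ⟩
    t i ∷ window n t (suc i)                                 ≡⟨ window-suc n t i ⟨
    window (suc n) t i                                       ∎
    where open ≡-Reasoning
          s = integrate t

  differences-∷ʳ : ∀ {n} (u : Vec (Fin q) (suc n)) x → differences (u ∷ʳ x) ≡ differences u ∷ʳ (x -ᶠ last u)
  differences-∷ʳ (y ∷ [])     x = refl
  differences-∷ʳ (y ∷ z ∷ u) x = cong ((z -ᶠ y) ∷_) (differences-∷ʳ (z ∷ u) x)

  module _ (μ : Fin q → ℕ) (c : ℕ) (μ-antisym : ∀ x y → μ (y -ᶠ x) + μ (x -ᶠ y) ≡ c) where

    weigh-differences-reverse : ∀ {n} (v : Vec (Fin q) (suc n)) →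
                                weigh μ (differences (reverse v)) + weigh μ (differences v) ≡ n * c
    weigh-differences-reverse (x ∷ [])     = refl
    weigh-differences-reverse {suc n} (x ∷ y ∷ v) = begin
      weigh μ (differences (reverse (x ∷ y ∷ v))) + weigh μ (differences (x ∷ y ∷ v))
        ≡⟨ cong (λ u → weigh μ (differences u) + weigh μ (differences (x ∷ y ∷ v))) (reverse-∷ x (y ∷ v)) ⟩
      weigh μ (differences (reverse (y ∷ v) ∷ʳ x)) + (μ (y -ᶠ x) + w)
        ≡⟨ cong (λ u → weigh μ u + (μ (y -ᶠ x) + w)) (differences-∷ʳ (reverse (y ∷ v)) x) ⟩
      weigh μ (differences (reverse (y ∷ v)) ∷ʳ (x -ᶠ last (reverse (y ∷ v)))) + (μ (y -ᶠ x) + w)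
        ≡⟨ cong (_+ (μ (y -ᶠ x) + w)) (weigh-∷ʳ μ (differences (reverse (y ∷ v))) (x -ᶠ last (reverse (y ∷ v)))) ⟩
      wʳ + μ (x -ᶠ last (reverse (y ∷ v))) + (μ (y -ᶠ x) + w)
        ≡⟨ cong (λ z → wʳ + μ (x -ᶠ z) + (μ (y -ᶠ x) + w)) (last-reverse (y ∷ v)) ⟩
      wʳ + μ (x -ᶠ y) + (μ (y -ᶠ x) + w)
        ≡⟨ lemma wʳ (μ (x -ᶠ y)) (μ (y -ᶠ x)) w ⟩
      (μ (y -ᶠ x) + μ (x -ᶠ y)) + (wʳ + w)
        ≡⟨ cong₂ _+_ (μ-antisym x y) (weigh-differences-reverse (y ∷ v)) ⟩
      c + n * c ∎
      where open ≡-Reasoning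
            w  = weigh μ (differences (y ∷ v))
            wʳ = weigh μ (differences (reverse (y ∷ v)))
            lemma : ∀ a b c d → a + b + (c + d) ≡ (c + b) + (a + d)
            lemma = solve-∀

    reversed-window-weights : ∀ t n i j → window (suc n) (integrate t) i ≡ reverse (window (suc n) (integrate t) j) →
                              weigh μ (window n t i) + weigh μ (window n t j) ≡ n * c
    reversed-window-weights t n i j eq = begin
      weigh μ (window n t i) + weigh μ (window n t j)
        ≡⟨ cong₂ (λ u v → weigh μ u + weigh μ v) (differences-window t n i) (differences-window t n j) ⟨
      weigh μ (differences (window (suc n) s i)) + weigh μ (differences (window (suc n) s j))
        ≡⟨ cong (λ u → weigh μ (differences u) + weigh μ (differences (window (suc n) s j))) eq ⟩
      weigh μ (differences (reverse (window (suc n) s j))) + weigh μ (differences (window (suc n) s j))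
        ≡⟨ weigh-differences-reverse (window (suc n) s j) ⟩
      n * c ∎
      where open ≡-Reasoning
            s = integrate t

  integrate-windowSeq : ∀ {t n m} → Periodic m t → IsWindowSeq n m t → Coprime q (partialSum (toℕ ∘ t) m) →
                        IsWindowSeq (suc n) (q * m) (integrate t)
  integrate-windowSeq {t} {n} {m} periodic windowSeq coprime i j eq =
    ∣∣-∣⇒[mod] i j (lift i j sᵢ≡sⱼ ([mod]⇒∣∣-∣ i j (windowSeq i j tᵢ≡tⱼ)))
    where
    s = integrate t
    S = partialSum (toℕ ∘ t)
    tᵢ≡tⱼ : window n t i ≡ window n t j
    tᵢ≡tⱼ = trans (sym (differences-window t n i)) (trans (cong differences eq) (differences-window t n j))
    sᵢ≡sⱼ : s i ≡ s j
    sᵢ≡sⱼ = trans (cong s (sym (+-identityʳ i))) (trans (cong head eq) (cong s (+-identityʳ j)))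
    lift≤ : ∀ {a b} → a ≤ b → s a ≡ s b → m ∣ b ∸ a → q * m ∣ b ∸ a
    lift≤ {a} {b} a≤b sa≡sb (divides d b∸a≡dm) = subst (q * m ∣_) (sym b∸a≡dm) (*-monoˡ-∣ m q∣d)
      where
      b≡ : b ≡ a + d * m
      b≡ = trans (sym (m+[n∸m]≡n a≤b)) (cong (_+_ a) b∸a≡dm)
      Sb≡ : S b ≡ S a + d * S m
      Sb≡ = trans (cong S b≡) (partialSum-+periods (cong toℕ ∘ periodic) d a)
      Sa%q≡Sb%q : S a % q ≡ S b % q
      Sa%q≡Sb%q = trans (sym (toℕ-mod (S a))) (trans (cong toℕ sa≡sb) (toℕ-mod (S b)))
      Sb∸Sa≡ : S b ∸ S a ≡ S m * d
      Sb∸Sa≡ = trans (cong (_∸ S a) Sb≡) (trans (m+n∸m≡n (S a) (d * S m)) (*-comm d (S m)))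
      q∣d : q ∣ d
      q∣d = coprime-divisor coprime (subst (q ∣_) Sb∸Sa≡ (%≡%⇒∣∸ Sa%q≡Sb%q))
    lift : ∀ a b → s a ≡ s b → m ∣ ∣ a - b ∣ → q * m ∣ ∣ a - b ∣
    lift a b sa≡sb m∣ with ≤-total a b
    ... | inj₁ a≤b = subst (λ x → m ∣ x → q * m ∣ x) (sym (m≤n⇒∣m-n∣≡n∸m a≤b)) (lift≤ a≤b sa≡sb) m∣
    ... | inj₂ b≤a = subst (λ x → m ∣ x → q * m ∣ x) (sym (m≤n⇒∣n-m∣≡n∸m b≤a)) (lift≤ b≤a (sym sa≡sb)) m∣

-- Pseudoweights

module _ {q : ℕ} .{{_ : NonZero q}} where

  -- 2f u is twice the pseudoweight f(u) of a letter, a natural number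
  2f : Fin q → ℕ
  2f u with toℕ u
  ... | zero  = q
  ... | suc j = 2 * suc j

  2f-opposite : ∀ a b → (toℕ a + toℕ b) % q ≡ 0 → 2f a + 2f b ≡ 2 * q
  2f-opposite a b sum≡0 with toℕ a | toℕ<n a | toℕ b | toℕ<n b
  ... | zero  | _   | zero  | _   = cong (_+_ q) (sym (+-identityʳ q))
  ... | zero  | _   | suc j | j<q = contradiction (trans (sym (m<n⇒m%n≡m j<q)) sum≡0) λ ()
  ... | suc i | i<q | zero  | _   = contradiction (trans (sym (m<n⇒m%n≡m i<q)) (trans (cong (_% q) (sym (+-identityʳ (suc i)))) sum≡0)) λ ()
  ... | suc i | i<q | suc j | j<q with m%n≡0⇒n∣m _ q sum≡0
  ...   | divides 1 i+j≡q = trans (sym (*-distribˡ-+ 2 (suc i) (suc j))) (cong (2 *_) (trans i+j≡q (+-identityʳ q)))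
  ...   | divides 0 ()
  ...   | divides (suc (suc d)) i+j≡ = contradiction (+-mono-< i<q j<q)
    (≤⇒≯ (subst (q + q ≤_) (sym i+j≡) (≤-trans (m≤m+n (q + q) (d * q)) (≤-reflexive (+-assoc q q (d * q))))))

  2f-difference : ∀ x y → 2f (y -ᶠ x) + 2f (x -ᶠ y) ≡ 2 * q
  2f-difference x y = 2f-opposite (y -ᶠ x) (x -ᶠ y) (-ᶠ-antisym x y)

  light-integrate-reverse-free : ∀ {t} n → (∀ i → weigh 2f (window n t i) < n * q) →
                                 ∀ i j → window (suc n) (integrate t) i ≢ V.reverse (window (suc n) (integrate t) j)
  light-integrate-reverse-free {t} n light i j eq =
    <-irrefl (trans (reversed-window-weights 2f (2 * q) 2f-difference t n i j eq) (lemma n q))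
             (+-mono-< (light i) (light j))
    where lemma : ∀ n q → n * (2 * q) ≡ n * q + n * q
          lemma = solve-∀

  negate : Fin q → Fin q
  negate u = (q ∸ toℕ u) mod q

  negate-opposite : ∀ u → (toℕ u + toℕ (negate u)) % q ≡ 0
  negate-opposite u = begin
    (toℕ u + toℕ (negate u)) % q    ≡⟨ cong (λ x → (toℕ u + x) % q) (toℕ-mod (q ∸ toℕ u)) ⟩
    (toℕ u + (q ∸ toℕ u) % q) % q   ≡⟨ cong (_% q) (+-comm (toℕ u) _) ⟩
    ((q ∸ toℕ u) % q + toℕ u) % q   ≡⟨ [m%q+n]%q≡[m+n]%q (q ∸ toℕ u) (toℕ u) ⟩
    (q ∸ toℕ u + toℕ u) % q         ≡⟨ cong (_% q) (m∸n+n≡m (<⇒≤ (toℕ<n u))) ⟩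
    q % q                           ≡⟨ n%n≡0 q ⟩
    0                               ∎
    where open ≡-Reasoning

  negate-injective : ∀ {a b} → negate a ≡ negate b → a ≡ b
  negate-injective {a} {b} eq = toℕ-injective (begin
    toℕ a          ≡⟨ m<n⇒m%n≡m (toℕ<n a) ⟨
    toℕ a % q      ≡⟨ %-cancelˡ-+ (toℕ (negate a)) (begin
      (toℕ (negate a) + toℕ a) % q   ≡⟨ cong (_% q) (+-comm _ (toℕ a)) ⟩
      (toℕ a + toℕ (negate a)) % q   ≡⟨ negate-opposite a ⟩
      0                              ≡⟨ negate-opposite b ⟨
      (toℕ b + toℕ (negate b)) % q   ≡⟨ cong (λ x → (toℕ b + toℕ x) % q) eq ⟨
      (toℕ b + toℕ (negate a)) % q   ≡⟨ cong (_% q) (+-comm (toℕ b) _) ⟩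
      (toℕ (negate a) + toℕ b) % q   ∎) ⟩
    toℕ b % q      ≡⟨ m<n⇒m%n≡m (toℕ<n b) ⟩
    toℕ b          ∎)
    where open ≡-Reasoning

  weigh-negate : ∀ {n} (v : Vec (Fin q) n) → weigh 2f (V.map negate v) + weigh 2f v ≡ n * (2 * q)
  weigh-negate = weigh-map-complement 2f negate (2 * q) (λ u → 2f-opposite (negate u) u
    (trans (cong (_% q) (+-comm (toℕ (negate u)) (toℕ u))) (negate-opposite u)))

half-+ : ∀ a b → (+ a) ℚ./ 2 ℚ.+ (+ b) ℚ./ 2 ≡ (+ (a + b)) ℚ./ 2
half-+ a b = ℚ.toℚᵘ-injective (begin
  ℚ.toℚᵘ ((+ a) ℚ./ 2 ℚ.+ (+ b) ℚ./ 2)            ≈⟨ ℚ.toℚᵘ-homo-+ ((+ a) ℚ./ 2) ((+ b) ℚ./ 2) ⟩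
  ℚ.toℚᵘ ((+ a) ℚ./ 2) ℚᵘ.+ ℚ.toℚᵘ ((+ b) ℚ./ 2)  ≈⟨ ℚᵘ.+-cong (ℚ.toℚᵘ-fromℚᵘ (mkℚᵘ (+ a) 1))
                                                               (ℚ.toℚᵘ-fromℚᵘ (mkℚᵘ (+ b) 1)) ⟩
  mkℚᵘ (+ a) 1 ℚᵘ.+ mkℚᵘ (+ b) 1              ≈⟨ *≡* (trans (lemma (+ a) (+ b)) (cong (ℤ._* + 4) (sym (ℤ.pos-+ a b)))) ⟩
  mkℚᵘ (+ (a + b)) 1                          ≈⟨ ℚ.toℚᵘ-fromℚᵘ (mkℚᵘ (+ (a + b)) 1) ⟨
  ℚ.toℚᵘ ((+ (a + b)) ℚ./ 2)                    ∎)
  where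
  open ℚᵘ.≃-Reasoning
  lemma : ∀ x y → (x ℤ.* + 2 ℤ.+ y ℤ.* + 2) ℤ.* + 2 ≡ (x ℤ.+ y) ℤ.* + 4
  lemma = ℤ-Solver.solve-∀

module _ {q : ℕ} .{{_ : NonZero q}} where

  pf≡2f/2 : ∀ u → pf q u ≡ (+ 2f u) ℚ./ 2
  pf≡2f/2 u with toℕ u
  ... | zero  = refl
  ... | suc j = ℚ.fromℚᵘ-cong {mkℚᵘ (+ suc j) 0} {mkℚᵘ (+ (2 * suc j)) 1} (*≡* (trans (ℤ.*-comm (+ suc j) (+ 2))
                  (trans (ℤ.pos-* 2 (suc j)) (sym (ℤ.*-identityʳ (+ (2 * suc j)))))))

  pseudoweight≡weigh/2 : ∀ {n} (v : Vec (Fin q) n) → pseudoweight v ≡ (+ weigh 2f v) ℚ./ 2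
  pseudoweight≡weigh/2 []      = sym (ℚ.0/n≡0 2)
  pseudoweight≡weigh/2 (u ∷ v) = trans (cong₂ ℚ._+_ (pf≡2f/2 u) (pseudoweight≡weigh/2 v)) (half-+ (2f u) (weigh 2f v))

period-bound : ∀ Q X R m t → X ≤ (m + t) + R + (m + t) →
               ((+ Q) ℤ.* ((+ X) ℤ.- (+ R) ℤ.- (+ (2 * t)))) ℚ./ 2 ℚ.≤ (+ (Q * m)) ℚ./ 1
period-bound Q X R m t X≤ = ℚ.toℚᵘ-cancel-≤ (ℚᵘ.≤-respʳ-≃ (ℚᵘ.≃-sym (ℚ.toℚᵘ-fromℚᵘ (mkℚᵘ (+ (Q * m)) 0)))
  (ℚᵘ.≤-respˡ-≃ (ℚᵘ.≃-sym (ℚ.toℚᵘ-fromℚᵘ (mkℚᵘ z 1))) (*≤* (begin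
    z ℤ.* + 1                         ≡⟨ ℤ.*-identityʳ z ⟩
    z                                 ≤⟨ ℤ.*-monoˡ-≤-nonNeg (+ Q) X-R-2t≤2m ⟩
    (+ Q) ℤ.* (+ (2 * m))             ≡⟨ lemma ⟩
    + (Q * m) ℤ.* + 2                 ∎))))
  where
  open ℤ.≤-Reasoning
  z = (+ Q) ℤ.* ((+ X) ℤ.- (+ R) ℤ.- (+ (2 * t)))
  X-R-2t≤2m : (+ X) ℤ.- (+ R) ℤ.- (+ (2 * t)) ℤ.≤ + (2 * m)
  X-R-2t≤2m = begin
    (+ X) ℤ.- (+ R) ℤ.- (+ (2 * t))
      ≤⟨ ℤ.+-monoˡ-≤ (ℤ.- (+ (2 * t))) (ℤ.+-monoˡ-≤ (ℤ.- (+ R)) (ℤ.+≤+ X≤)) ⟩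
    + ((m + t) + R + (m + t)) ℤ.- (+ R) ℤ.- (+ (2 * t))
      ≡⟨ cong₂ (λ a b → a ℤ.- (+ R) ℤ.- b) (trans (ℤ.pos-+ (m + t + R) (m + t))
           (cong₂ ℤ._+_ (trans (ℤ.pos-+ (m + t) R) (cong (ℤ._+ + R) (ℤ.pos-+ m t))) (ℤ.pos-+ m t))) (ℤ.pos-* 2 t) ⟩
    ((+ m) ℤ.+ (+ t)) ℤ.+ (+ R) ℤ.+ ((+ m) ℤ.+ (+ t)) ℤ.- (+ R) ℤ.- (+ 2) ℤ.* (+ t)
      ≡⟨ lemma₁ (+ m) (+ t) (+ R) ⟩
    (+ 2) ℤ.* (+ m)
      ≡⟨ ℤ.pos-* 2 m ⟨
    + (2 * m) ∎
    where lemma₁ : ∀ m t r → (m ℤ.+ t) ℤ.+ r ℤ.+ (m ℤ.+ t) ℤ.- r ℤ.- (+ 2) ℤ.* t ≡ (+ 2) ℤ.* m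
          lemma₁ = ℤ-Solver.solve-∀
  lemma : (+ Q) ℤ.* (+ (2 * m)) ≡ + (Q * m) ℤ.* + 2
  lemma = trans (sym (ℤ.pos-* Q (2 * m))) (trans (cong +_ (lemma₂ Q m)) (ℤ.pos-* (Q * m) 2))
    where lemma₂ : ∀ Q m → Q * (2 * m) ≡ Q * m * 2
          lemma₂ = solve-∀

module _ {q : ℕ} where

  allTuples-cartesian : ∀ n → allTuples q (suc n) ≡ cartesianProductWith _∷_ (allFin q) (allTuples q n)
  allTuples-cartesian n = concatMap≡ (allFin q)
    where
    concatMap≡ : ∀ xs → concatMap (λ u → map (u ∷_) (allTuples q n)) xs ≡ cartesianProductWith _∷_ xs (allTuples q n)
    concatMap≡ []       = refl
    concatMap≡ (x ∷ xs) = cong (map (x ∷_) (allTuples q n) ++_) (concatMap≡ xs)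

  length-allTuples : ∀ n → length (allTuples q n) ≡ q ^ n
  length-allTuples zero    = refl
  length-allTuples (suc n) = trans (cong length (allTuples-cartesian n))
    (trans (length-cartesianProductWith _∷_ (allFin q) (allTuples q n)) (cong₂ _*_ (length-tabulate {n = q} id) (length-allTuples n)))

  allTuples-unique : ∀ n → Unique (allTuples q n)
  allTuples-unique zero    = [] ∷ []
  allTuples-unique (suc n) = subst Unique (sym (allTuples-cartesian n))
    (cartesianProductWith⁺ _∷_ Vecₚ.∷-injective (allFin⁺ q) (allTuples-unique n))

  ∈-allTuples : ∀ {n} (v : Vec (Fin q) n) → v ∈ allTuples q n
  ∈-allTuples []              = here refl
  ∈-allTuples {suc n} (u ∷ v) = subst (_ ∈_) (sym (allTuples-cartesian n))
    (∈-cartesianProductWith⁺ _∷_ (∈-allFin u) (∈-allTuples v))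

module _ {q : ℕ} .{{_ : NonZero q}} where

  count-light : ∀ n (L : List (Vec (Fin q) n)) → (∀ {v} → weigh 2f v < n * q → v ∈ L) →
                q ^ n ≤ length L + r q n ((+ (n * q)) ℚ./ 2) + length L
  count-light n L light⊆L = begin
    q ^ n                                                        ≡⟨ length-allTuples n ⟨
    length all                                                   ≡⟨ cong length (filter-all (light? ∪? balanced? ∪? heavy?) {all}
                                                                      (All.tabulate (λ {v} _ → classify v))) ⟨
    length (filter (light? ∪? balanced? ∪? heavy?) all)          ≤⟨ length-filter-∪ light? (balanced? ∪? heavy?) all ⟩
    #light + length (filter (balanced? ∪? heavy?) all)           ≤⟨ +-monoʳ-≤ #light (length-filter-∪ balanced? heavy? all) ⟩
    #light + (r q n s + #heavy)                                  ≤⟨ +-mono-≤ #light≤ (+-monoʳ-≤ (r q n s) #heavy≤) ⟩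
    length L + (r q n s + length L)                              ≡⟨ +-assoc (length L) (r q n s) (length L) ⟨
    length L + r q n s + length L                                ∎
    where
    open ≤-Reasoning
    all = allTuples q n
    s = (+ (n * q)) ℚ./ 2
    light? : Decidable (λ v → weigh 2f v < n * q)
    light? v = weigh 2f v <? n * q
    heavy? : Decidable (λ v → n * q < weigh 2f v)
    heavy? v = n * q <? weigh 2f v
    balanced? : Decidable (λ v → pseudoweight v ≡ s)
    balanced? v = pseudoweight v ℚ.≟ s
    #light = length (filter light? all)
    #heavy = length (filter heavy? all)
    classify : ∀ v → weigh 2f v < n * q ⊎ pseudoweight v ≡ s ⊎ n * q < weigh 2f v
    classify v with <-cmp (weigh 2f v) (n * q)
    ... | tri< light _ _ = inj₁ light
    ... | tri≈ _ balanced _ = inj₂ (inj₁ (trans (pseudoweight≡weigh/2 v) (cong (λ x → (+ x) ℚ./ 2) balanced)))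
    ... | tri> _ _ heavy = inj₂ (inj₂ heavy)
    #light≤ : #light ≤ length L
    #light≤ = Unique-⊆⇒length≤ (filter⁺ light? (allTuples-unique n))
                               (λ v∈ → light⊆L (proj₂ (∈-filter⁻ light? {xs = all} v∈)))
    #heavy≤ : #heavy ≤ length L
    #heavy≤ = subst (_≤ length L) (length-map (V.map negate) (filter heavy? all))
      (Unique-⊆⇒length≤ (map⁺ (map-injective negate-injective) (filter⁺ heavy? (allTuples-unique n))) negated⊆L)
      where
      negated⊆L : ∀ {w} → w ∈ map (V.map negate) (filter heavy? all) → w ∈ L
      negated⊆L w∈ with ∈-map⁻ (V.map negate) w∈
      ... | v , v∈ , refl = light⊆L (+-cancelʳ-< (weigh 2f v) _ _ (begin-strict
        weigh 2f (V.map negate v) + weigh 2f v   ≡⟨ weigh-negate v ⟩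
        n * (2 * q)                               ≡⟨ lemma n q ⟩
        n * q + n * q                             <⟨ +-monoʳ-< (n * q) (proj₂ (∈-filter⁻ heavy? {xs = all} v∈)) ⟩
        n * q + weigh 2f v                        ∎))
        where lemma : ∀ n q → n * (2 * q) ≡ n * q + n * q
              lemma = solve-∀

module Construction (a b : ℕ) where

  q : ℕ
  q = 3 + a

  k : ℕ
  k = suc b

  open DeBruijn (Fin._≟_ {q}) k public

  Light : Word → Set
  Light v = weigh 2f v < suc k * q

  one : Fin q
  one = suc zero

  2f-one-min : ∀ (c : Fin q) → 2f one ≤ 2f c
  2f-one-min zero          = s≤s (s≤s z≤n)
  2f-one-min (suc zero)    = ≤-refl
  2f-one-min (suc (suc c)) = s≤s (s≤s z≤n)

  light-loop : ∀ c {j} → toℕ c ≡ suc j → 2 * suc j < q → Light (replicate (suc k) c)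
  light-loop c c≡ 2c<q = subst (_< suc k * q) (sym (weigh-replicate 2f (suc k) c)) (*-monoʳ-< (suc k) (subst (_< q) (sym (2f≡ c c≡)) 2c<q))
    where
    2f≡ : ∀ u {j} → toℕ u ≡ suc j → 2f u ≡ 2 * suc j
    2f≡ u eq with toℕ u
    ... | suc _ = cong (2 *_) eq

  light-rot : ∀ {v} → Light v → Light (rot v)
  light-rot {v} = subst (_< suc k * q) (sym (weigh-rot 2f v))

  light-lower : ∀ {v} → Light v → Light (one ∷ tail v)
  light-lower {c ∷ w} light = ≤-<-trans (+-monoˡ-≤ (weigh 2f w) (2f-one-min c)) light

  full : Σ Cycle λ C → (∀ {z} → z ∈ vertices C → Light z) × (∀ {z} → Light z → z ∈ vertices C)
  full = let C , (light , _) , ⊇ = Covering.good-cycle-through one Light (λ {v} → light-rot {v}) (λ {v} → light-lower {v})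
                                     (light-loop one refl (s≤s (s≤s (s≤s z≤n))))
                                     (filter light? (allTuples q (suc k)))
                                     (λ z∈ → proj₂ (∈-filter⁻ light? {xs = allTuples q (suc k)} z∈))
         in C , light , λ {z} Lz → ⊇ (∈-filter⁺ light? (∈-allTuples z) Lz)
    where
    light? : Decidable Light
    light? v = weigh 2f v <? suc k * q

  Cfull : Cycle
  Cfull = proj₁ full

  Cfull-light : ∀ {z} → z ∈ vertices Cfull → Light z
  Cfull-light = proj₁ (proj₂ full)

  Cfull-complete : ∀ {z} → Light z → z ∈ vertices Cfull
  Cfull-complete = proj₂ (proj₂ full)

  headSum : List Word → ℕ
  headSum L = sum (map (toℕ ∘ head) L)

  -- a light word that is not a loop, keeping the cycle nonempty while loops are dropped
  v₀ : Word
  v₀ = zero ∷ replicate k one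

  v₀-light : Light v₀
  v₀-light = subst (_< suc k * q) (sym (cong (_+_ q) (weigh-replicate 2f k one)))
               (+-monoʳ-< q (*-monoʳ-< k (s≤s (s≤s (s≤s z≤n)))))

  v₀≢loop : ∀ c → 0 < toℕ c → v₀ ≢ replicate (suc k) c
  v₀≢loop c 0<c v₀≡cᵏ = <⇒≢ 0<c (cong toℕ (Vecₚ.∷-injectiveˡ v₀≡cᵏ))

  module _ {L L' : List Word} {x : Word} (L↭x∷L' : L ↭ x ∷ L') where

    ∈-after-removal : ∀ {z} → z ∈ L → z ≢ x → z ∈ L'
    ∈-after-removal z∈L z≢x with ∈-resp-↭ L↭x∷L' z∈L
    ... | here z≡x = contradiction z≡x z≢x
    ... | there z∈L' = z∈L'

    ⊆-after-removal : L' ⊆ L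
    ⊆-after-removal z∈L' = ∈-resp-↭ (↭-sym L↭x∷L') (there z∈L')

    headSum-after-removal : headSum L ≡ toℕ (head x) + headSum L'
    headSum-after-removal = sum-↭ (↭-map⁺ (toℕ ∘ head) L↭x∷L')

  record Trimmed : Set where
    field
      C         : Cycle
      removed   : ℕ
      ⊆full     : vertices C ⊆ vertices Cfull
      length≡   : length (vertices Cfull) ≡ removed + length (vertices C)
      at-most-2 : removed ≤ 2
      at-most-1 : q ≢ 6 → removed ≤ 1
      coprime   : Coprime q (headSum (vertices C))

  W : ℕ
  W = headSum (vertices Cfull)

  untrimmed : Coprime q W → Trimmed
  untrimmed coprime = record
    { C = Cfull ; removed = 0 ; ⊆full = id ; length≡ = refl ; at-most-2 = z≤n ; at-most-1 = λ _ → z≤n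
    ; coprime = coprime }

  trim-one : ∀ {u} j → Coprime q u → 2 * suc j < q → (u + suc j) % q ≡ W % q → Trimmed
  trim-one {u} j coprime 2c<q u+c≡W = record
    { C = C₁ ; removed = 1 ; ⊆full = ⊆-after-removal Cfull↭ ; length≡ = ↭-length Cfull↭ ; at-most-2 = s≤s z≤n
    ; at-most-1 = λ _ → ≤-refl
    ; coprime = coprime-resp-% coprime (%-cancelˡ-+ (suc j) {u} {headSum (vertices C₁)} (begin
        (suc j + u) % q                       ≡⟨ cong (_% q) (+-comm (suc j) u) ⟩
        (u + suc j) % q                       ≡⟨ u+c≡W ⟩
        W % q                                 ≡⟨ cong (_% q) (headSum-after-removal Cfull↭) ⟩
        (toℕ c + headSum (vertices C₁)) % q   ≡⟨ cong (λ x → (x + headSum (vertices C₁)) % q) (toℕ-fromℕ< c<q) ⟩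
        (suc j + headSum (vertices C₁)) % q   ∎)) }
    where
    open ≡-Reasoning
    c<q : suc j < q
    c<q = ≤-trans (s≤s (m≤m+n (suc j) (suc j + 0))) 2c<q
    c : Fin q
    c = fromℕ< c<q
    removal : Σ Cycle λ C₁ → vertices Cfull ↭ replicate (suc k) c ∷ vertices C₁
    removal = remove-loop Cfull (Cfull-complete (light-loop c (toℕ-fromℕ< c<q) 2c<q)) (Cfull-complete v₀-light)
                                (v₀≢loop c (subst (0 <_) (sym (toℕ-fromℕ< c<q)) z<s))
    C₁ = proj₁ removal
    Cfull↭ = proj₂ removal

  trim-two : q ≡ 6 → W % q ≡ 4 → Trimmed
  trim-two q≡6 W%q≡4 = record
    { C = C₂ ; removed = 2 ; ⊆full = ⊆-after-removal Cfull↭ ∘ ⊆-after-removal C₁↭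
    ; length≡ = trans (↭-length Cfull↭) (cong suc (↭-length C₁↭)) ; at-most-2 = ≤-refl
    ; at-most-1 = λ q≢6 → contradiction q≡6 q≢6
    ; coprime = coprime-resp-% (Coprime.sym (1-coprimeTo q)) (%-cancelˡ-+ 3 {1} {headSum (vertices C₂)} (begin
        (3 + 1) % q                           ≡⟨ m<n⇒m%n≡m 4<q ⟩
        4                                     ≡⟨ W%q≡4 ⟨
        W % q                                 ≡⟨ cong (_% q) (trans (headSum-after-removal Cfull↭)
                                                               (cong (_+_ 1) (headSum-after-removal C₁↭))) ⟩
        (1 + (2 + headSum (vertices C₂))) % q ∎)) }
    where
    open ≡-Reasoning
    two : Fin q
    two = suc (suc zero)
    4<q : 4 < q
    4<q = subst (4 <_) (sym q≡6) (s≤s (s≤s (s≤s (s≤s (s≤s z≤n)))))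
    removal₁ : Σ Cycle λ C₁ → vertices Cfull ↭ replicate (suc k) one ∷ vertices C₁
    removal₁ = remove-loop Cfull (Cfull-complete (light-loop one refl (s≤s (s≤s (s≤s z≤n))))) (Cfull-complete v₀-light)
                                 (v₀≢loop one z<s)
    C₁ = proj₁ removal₁
    Cfull↭ = proj₂ removal₁
    removal₂ : Σ Cycle λ C₂ → vertices C₁ ↭ replicate (suc k) two ∷ vertices C₂
    removal₂ = remove-loop C₁ (∈-after-removal Cfull↭ (Cfull-complete (light-loop two refl 4<q)) λ ())
                              (∈-after-removal Cfull↭ (Cfull-complete v₀-light) λ ()) (v₀≢loop two z<s)
    C₂ = proj₁ removal₂
    C₁↭ = proj₂ removal₂

  trimmed : Trimmed
  trimmed with (q ≟ 6) ×-dec (W % q ≟ 4)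
  ... | yes (q≡6 , W%q≡4) = trim-two q≡6 W%q≡4
  ... | no exception with unit-within-half q (s≤s (s≤s (s≤s z≤n))) (W % q) (m%n<n W q) exception
  ...   | u , zero  , coprime , _    , u+0≡W = untrimmed (coprime-resp-% coprime (trans (cong (_% q) (sym (+-identityʳ u))) u+0≡W))
  ...   | u , suc j , coprime , 2c<q , u+c≡W = trim-one j coprime 2c<q u+c≡W

  open Trimmed trimmed public

  sequence : ℕ → Fin q
  sequence = integrate (head ∘ walk C)

  orientable : IsOrientable (suc (suc k)) (q * period C) sequence
  orientable = integrate-windowSeq (cycle-periodic k C) (cycle-windowSeq k C) (subst (Coprime q) headSum≡ coprime) ,
               light-integrate-reverse-free (suc k) light-window
    where
    headSum≡ : headSum (vertices C) ≡ partialSum (toℕ ∘ head ∘ walk C) (period C)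
    headSum≡ = cong sum (trans (cong (map (toℕ ∘ head)) (sym (applyUpTo-walk C))) (map-applyUpTo (walk C) (toℕ ∘ head) (period C)))
    light-window : ∀ i → weigh 2f (window (suc k) (head ∘ walk C) i) < suc k * q
    light-window i = subst Light (sym (cycle-windows k C i)) (Cfull-light (⊆full (walk-∈ C i)))

  count-bound : ∀ {m} → removed ≤ m → q ^ suc k ≤ (period C + m) + r q (suc k) ((+ (suc k * q)) ℚ./ 2) + (period C + m)
  count-bound {m} removed≤m = ≤-trans (count-light (suc k) (vertices Cfull) Cfull-complete) (+-mono-≤ (+-monoˡ-≤ _ Lfull≤) Lfull≤)
    where
    Lfull≤ : length (vertices Cfull) ≤ period C + m
    Lfull≤ = subst (_≤ period C + m) (sym length≡)
               (subst (removed + period C ≤_) (+-comm m (period C)) (+-monoˡ-≤ (period C) removed≤m))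

theorem5 : (n q : ℕ) → 2 < n → 2 < q →
    Σ ℕ λ m → Σ (ℕ → Fin q) λ s →
      0 < m × Periodic m s × IsOrientable n m s ×
      ((¬ (q ≡ 6) → ((+ q) ℤ.* ((+ (q ^ (n ∸ 1))) ℤ.- (+ r q (n ∸ 1) ((+ ((n ∸ 1) * q)) ℚ./ 2)) ℤ.- (+ 2))) ℚ./ 2 ℚ.≤ (+ m) ℚ./ 1)
       × (q ≡ 6 → ((+ q) ℤ.* ((+ (q ^ (n ∸ 1))) ℤ.- (+ r q (n ∸ 1) ((+ ((n ∸ 1) * q)) ℚ./ 2)) ℤ.- (+ 4))) ℚ./ 2 ℚ.≤ (+ m) ℚ./ 1))
theorem5 (suc (suc (suc b))) (suc (suc (suc a))) _ _ =
  q * period C , sequence , z<s , integrate-periodic (cycle-periodic k C) , orientable ,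
  (λ q≢6 → period-bound q (q ^ suc k) _ (period C) 1 (count-bound (at-most-1 q≢6))) ,
  (λ _ → period-bound q (q ^ suc k) _ (period C) 2 (count-bound at-most-2))
  where open Construction a b
theorem5 0                   _ () _
theorem5 1                   _ (s≤s ()) _
theorem5 2                   _ (s≤s (s≤s ())) _
theorem5 (suc (suc (suc _))) 0 _ ()
theorem5 (suc (suc (suc _))) 1 _ (s≤s ())
theorem5 (suc (suc (suc _))) 2 _ (s≤s (s≤s ()))
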